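{- Let $\mathcal{S}$ be a degree sequence with a realizing topological ordering $\phi=v_1,\ldots,v_n$, and let $\phi'$ be a partial topological ordering for a degree sequence $\mathcal{S}'$ with input and output potential both equal to $p$. Then for every index $1\le i\le n$ with $p^\phi_i=p$, the ordering $\phi''=\phi[1,i]\phi'\phi[i+1,n]$ is a realizing topological ordering for $\mathcal{S}\uplus\mathcal{S}'$, and the realizing dag can be chosen such that $p^\phi_j=p^{\phi''}_{j+|\phi'|}$ for all $i<j\le n$.
   Context: Fix a positive integer $\Delta$; all degrees are at most $\Delta$. A degree sequence is a multiset of pairs $\binom{a}{b}$ of nonnegative integers ($a$ indegree, $b$ outdegree); $\uplus$ is multiset sum. A dag (directed acyclic graph without parallel arcs and self-loops) realizes it if its vertices are in bijection with the elements with matching in/outdegrees. A topological ordering of a dag orders all vertices so that all arcs go forward; a realizing topological ordering for $\mathcal{S}$ is a topological ordering of some dag realizing $\mathcal{S}$; a sequence of elements (vertices with prescribed degrees) is a realizing topological ordering for a degree sequence if there is a dag realizing it with the vertices in that order forming a topological ordering. $\phi[i,j]=v_i,\ldots,v_j$; juxtaposition is concatenation; $|\phi'|$ is the length. Potential: for a dag with topological ordering $v_1,\ldots,v_n$ and $0\le i\le n$, $p_i\in\mathbb{N}^\Delta$ with $p_i[l]$ the number of vertices among $v_1,\ldots,v_i$ with at least $l$ neighbors among $v_{i+1},\ldots,v_n$; value $\omega(p)=\sum_{l=1}^\Delta p[l]$. Partial topological ordering: given a degree sequence $\mathcal{S}$ with $n$ elements and $p^s,p^t\in\mathbb{N}^\Delta$,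 let $P^s$ be a degree sequence of $p^s[1]$ elements of the form $\binom{0}{b}$ such that for each $1\le l\le\Delta$ exactly $p^s[l]$ of them have $b\ge l$, and let $P^t$ consist of $\omega(p^t)$ elements $\binom{1}{0}$. If $\psi$ is a realizing topological ordering for $\mathcal{S}\uplus P^s\uplus P^t$ in which the vertices of $P^s$ come first and those of $P^t$ come last, and the potential at position $p^s[1]+n$ equals $p^t$, then $\psi[p^s[1]+1,p^s[1]+n]$ is a partial topological ordering for $\mathcal{S}$ with input potential $p^s$ and output potential $p^t$. -}

module Defs where

open import Data.Nat using (ℕ; zero; suc; _+_; _≤_; _<_; _≤ᵇ_; _<ᵇ_; NonZero)
open import Data.Bool using (Bool; true; false; if_then_else_; _∧_; _∨_)
open import Data.Fin using (Fin; toℕ)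
import Data.Fin as F
open import Data.List using (List; []; _∷_; length; lookup; map; allFin; replicate; _++_)
open import Data.Nat.ListAction using (sum)
open import Data.List.Relation.Unary.All using (All)
open import Data.List.Relation.Binary.Permutation.Propositional using (_↭_)
open import Data.Vec using (Vec; tabulate)
import Data.Vec as V
open import Data.Product using (_×_; _,_; proj₁; proj₂; Σ; ∃)
open import Relation.Binary.PropositionalEquality using (_≡_)

-- An element of a degree sequence: (indegree , outdegree).
Elem : Set
Elem = ℕ × ℕ

-- Degree sequences (multisets) are lists up to permutation (_↭_); ⊎ is _++_.
DegSeq : Set
DegSeq = List Elem

Bounded : ℕ → Elem → Set
Bounded Δ (a , b) = a ≤ Δ × b ≤ Δ

countF : {n : ℕ} → (Fin n → Bool) → ℕ
countF {n} f = sum (map (λ k → if f k then 1 else 0) (allFin n))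

-- A dag on vertices v_1..v_n (indexed by Fin n, 0-based) for which v_1..v_n
-- is a topological ordering: arcs only go forward.  Being a relation, there
-- are no parallel arcs; forwardness excludes self-loops and cycles.
record TopDag (n : ℕ) : Set where
  field
    arc     : Fin n → Fin n → Bool
    forward : ∀ i j → arc i j ≡ true → toℕ i < toℕ j
open TopDag public

indeg : {n : ℕ} → TopDag n → Fin n → ℕ
indeg G j = countF (λ i → arc G i j)

outdeg : {n : ℕ} → TopDag n → Fin n → ℕ
outdeg G i = countF (λ j → arc G i j)

Realizes : (φ : List Elem) → TopDag (length φ) → Set
Realizes φ G = ∀ k → (indeg G k ≡ proj₁ (lookup φ k)) × (outdeg G k ≡ proj₂ (lookup φ k))

RTOWith : (φ : List Elem) → DegSeq → TopDag (length φ) → Set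
RTOWith φ S G = (φ ↭ S) × Realizes φ G

RTO : List Elem → DegSeq → Set
RTO φ S = Σ (TopDag (length φ)) (RTOWith φ S)

-- Potential vectors in ℕ^Δ; entry l : Fin Δ stands for index toℕ l + 1.
Pot : ℕ → Set
Pot Δ = Vec ℕ Δ

-- number of neighbours of vertex k among positions i+1..n (0-based: toℕ m ≥ i)
nbrsAfter : {n : ℕ} → TopDag n → ℕ → Fin n → ℕ
nbrsAfter G i k = countF (λ m → (i ≤ᵇ toℕ m) ∧ (arc G k m ∨ arc G m k))

-- potential p_i (0 ≤ i ≤ n): p_i[l] = #{ k among v_1..v_i with ≥ l neighbours among v_{i+1}..v_n }
pot : (Δ : ℕ) → {n : ℕ} → TopDag n → ℕ → Pot Δ
pot Δ G i = tabulate (λ l → countF (λ k → (toℕ k <ᵇ i) ∧ (suc (toℕ l) ≤ᵇ nbrsAfter G i k)))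

ω : {Δ : ℕ} → Pot Δ → ℕ
ω p = V.foldr _ _+_ 0 p

first : (Δ : ℕ) → .{{NonZero Δ}} → Fin Δ
first (suc _) = F.zero

IsPs : (Δ : ℕ) → .{{NonZero Δ}} → Pot Δ → DegSeq → Set
IsPs Δ ps P =
  (length P ≡ V.lookup ps (first Δ)) ×
  All (λ e → (proj₁ e ≡ 0) × (proj₂ e ≤ Δ)) P ×
  (∀ (l : Fin Δ) → countF {length P} (λ k → suc (toℕ l) ≤ᵇ proj₂ (lookup P k)) ≡ V.lookup ps l)

Pt : {Δ : ℕ} → Pot Δ → DegSeq
Pt pt = replicate (ω pt) (1 , 0)

-- φ' is a partial topological ordering for S' with input potential ps and output potential pt.
-- ψ = A φ' B with A a listing of P^s (first) and B a listing of P^t (last); then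
-- φ' = ψ[p^s[1]+1, p^s[1]+n].  |φ'| = n = |S'| follows from ψ ↭ S' ⊎ P^s ⊎ P^t.
PartialTO : (Δ : ℕ) → .{{NonZero Δ}} → List Elem → DegSeq → Pot Δ → Pot Δ → Set
PartialTO Δ φ' S' ps pt =
  Σ DegSeq λ Ps → IsPs Δ ps Ps × Σ (List Elem) λ A → Σ (List Elem) λ B →
    (A ↭ Ps) × (B ↭ Pt pt) ×
    Σ (TopDag (length (A ++ φ' ++ B))) λ G →
      RTOWith (A ++ φ' ++ B) (S' ++ Ps ++ Pt pt) G ×
      (pot Δ G (length A + length φ') ≡ pt)

module Submission where

-- Write ψ = A φ' B for the ordering witnessing that φ' is a partial topological ordering, A listing
-- the sources P^s and B the sinks P^t.  Since the potential of φ at i is p, the outdegrees of the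
-- sources (whose profile is p) can be matched, value for value, with the numbers c(u) of arcs from
-- v_u, u ≤ i, across the cut into φ[i+1,n] (matching T); since the output potential of φ' is also
-- p, the vertices of A φ' can likewise be matched with v_1 … v_i by their numbers of arcs into B
-- (matching R).  The new dag keeps all arcs inside φ[1,i], inside φ' and inside φ[i+1,n] except
-- those crossing the cut; v_u takes over the arcs of its T-partner source, and every arc of ψ into
-- B is redirected to the targets across the cut of the R-partner of its tail.  Partners have equal
-- values, so all degrees are preserved, and a vertex before a later cut j sees φ[j+1,n] exactly as
-- its partners did, so the potential is unchanged there.

open import Defs
open import Data.Bool using (Bool; true; false; if_then_else_; _∧_; _∨_; T)
open import Data.Bool.Properties using (∨-identityʳ)
open import Data.Empty using (⊥-elim)
open import Data.Fin using (Fin; toℕ; fromℕ<)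
import Data.Fin as Fin
import Data.Fin.Properties as Finₚ
open import Data.List using (List; []; _∷_; length; lookup; map; _++_; take; drop)
import Data.List as List
import Data.List.Properties as Listₚ
open import Data.List.Relation.Binary.Permutation.Propositional using (_↭_; ↭-sym; ↭-trans; ↭-reflexive)
import Data.List.Relation.Binary.Permutation.Propositional.Properties as ↭ₚ
open import Data.List.Relation.Unary.All using (All; _∷_)
open import Data.Nat
open import Data.Nat.ListAction using (sum)
open import Data.Nat.ListAction.Properties using (sum-↭)
open import Data.Nat.Properties
open import Data.Product using (_×_; _,_; proj₁; proj₂; Σ)
open import Data.Sum using (_⊎_; inj₁; inj₂)
import Data.Vec as Vec
import Data.Vec.Properties as Vecₚ
open import Function using (_∘_)
open import Relation.Binary.PropositionalEquality
open import Relation.Nullary using (¬_; yes; no)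
open import Algebra.Properties.CommutativeSemigroup +-commutativeSemigroup
  using () renaming (interchange to +-interchange)

-- Sums over initial segments of ℕ rather than over Fin, so that the blocks i + y and i + (m + t)
-- of a concatenation can be addressed without Fin arithmetic.
∑ : ℕ → (ℕ → ℕ) → ℕ
∑ zero    f = 0
∑ (suc n) f = f 0 + ∑ n (f ∘ suc)

syntax ∑ n (λ k → e) = ∑[ k < n ] e

⟦_⟧ : Bool → ℕ
⟦ b ⟧ = if b then 1 else 0

∑-cong : ∀ n {f g : ℕ → ℕ} → (∀ k → k < n → f k ≡ g k) → ∑ n f ≡ ∑ n g
∑-cong zero    eq = refl
∑-cong (suc n) eq = cong₂ _+_ (eq 0 z<s) (∑-cong n (λ k k<n → eq (suc k) (s<s k<n)))

∑-≡0 : ∀ n {f : ℕ → ℕ} → (∀ k → k < n → f k ≡ 0) → ∑ n f ≡ 0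
∑-≡0 n eq = trans (∑-cong n eq) (zeros n)
  where zeros : ∀ n → ∑[ _ < n ] 0 ≡ 0
        zeros zero    = refl
        zeros (suc n) = zeros n

∑-split : ∀ a b (f : ℕ → ℕ) → ∑ (a + b) f ≡ ∑ a f + ∑[ k < b ] f (a + k)
∑-split zero    b f = refl
∑-split (suc a) b f = trans (cong (f 0 +_) (∑-split a b (f ∘ suc))) (sym (+-assoc (f 0) _ _))

∑-split₃ : ∀ a b c (f : ℕ → ℕ) →
  ∑ (a + (b + c)) f ≡ ∑ a f + (∑[ k < b ] f (a + k) + ∑[ k < c ] f (a + (b + k)))
∑-split₃ a b c f = trans (∑-split a (b + c) f) (cong (∑ a f +_) (∑-split b c (f ∘ (a +_))))

∑-distrib-+ : ∀ n (f g : ℕ → ℕ) → ∑[ k < n ] (f k + g k) ≡ ∑ n f + ∑ n g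
∑-distrib-+ zero    f g = refl
∑-distrib-+ (suc n) f g =
  trans (cong (f 0 + g 0 +_) (∑-distrib-+ n (f ∘ suc) (g ∘ suc))) (+-interchange (f 0) (g 0) _ _)

∑-distribˡ-* : ∀ n c (f : ℕ → ℕ) → ∑[ k < n ] (c * f k) ≡ c * ∑ n f
∑-distribˡ-* zero    c f = sym (*-zeroʳ c)
∑-distribˡ-* (suc n) c f =
  trans (cong (c * f 0 +_) (∑-distribˡ-* n c (f ∘ suc))) (sym (*-distribˡ-+ c (f 0) _))

∑-distribʳ-* : ∀ n c (f : ℕ → ℕ) → ∑[ k < n ] (f k * c) ≡ ∑ n f * c
∑-distribʳ-* n c f =
  trans (∑-cong n (λ k _ → *-comm (f k) c)) (trans (∑-distribˡ-* n c f) (*-comm c _))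

∑-comm : ∀ n m (f : ℕ → ℕ → ℕ) → ∑[ x < n ] ∑[ y < m ] f x y ≡ ∑[ y < m ] ∑[ x < n ] f x y
∑-comm zero    m f = sym (∑-≡0 m (λ _ _ → refl))
∑-comm (suc n) m f =
  trans (cong (∑ m (f 0) +_) (∑-comm n m (f ∘ suc))) (sym (∑-distrib-+ m (f 0) _))

∑∑-distribˡ-* : ∀ ρ n (w : ℕ → ℕ) (F : ℕ → ℕ → ℕ) →
  ∑[ t < ρ ] ∑[ x < n ] (w x * F x t) ≡ ∑[ x < n ] (w x * ∑[ t < ρ ] F x t)
∑∑-distribˡ-* ρ n w F = trans (∑-comm ρ n _) (∑-cong n (λ x _ → ∑-distribˡ-* ρ (w x) (F x)))

∑-mono-≤ : ∀ n {f g : ℕ → ℕ} → (∀ k → k < n → f k ≤ g k) → ∑ n f ≤ ∑ n g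
∑-mono-≤ zero    le = z≤n
∑-mono-≤ (suc n) le = +-mono-≤ (le 0 z<s) (∑-mono-≤ n (λ k k<n → le (suc k) (s<s k<n)))

term≤∑ : ∀ n (f : ℕ → ℕ) k → k < n → f k ≤ ∑ n f
term≤∑ (suc n) f zero    _         = m≤m+n (f 0) _
term≤∑ (suc n) f (suc k) (s<s k<n) = ≤-trans (term≤∑ n (f ∘ suc) k k<n) (m≤n+m _ (f 0))

∑-pos⇒term-pos : ∀ n (f : ℕ → ℕ) → 0 < ∑ n f → Σ ℕ λ k → k < n × 0 < f k
∑-pos⇒term-pos (suc n) f pos with f 0 in eq
... | suc _ = 0 , z<s , subst (0 <_) (sym eq) z<s
... | zero  = let k , k<n , fk>0 = ∑-pos⇒term-pos n (f ∘ suc) pos in suc k , s<s k<n , fk>0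

≡ᵇ-refl : ∀ n → (n ≡ᵇ n) ≡ true
≡ᵇ-refl zero    = refl
≡ᵇ-refl (suc n) = ≡ᵇ-refl n

≡ᵇ-true⇒≡ : ∀ m n → (m ≡ᵇ n) ≡ true → m ≡ n
≡ᵇ-true⇒≡ m n eq = ≡ᵇ⇒≡ m n (subst T (sym eq) _)

∑-point : ∀ n k₀ c → k₀ < n → ∑[ k < n ] (if k ≡ᵇ k₀ then c else 0) ≡ c
∑-point (suc n) zero     c _         = trans (cong (c +_) (∑-≡0 n (λ _ _ → refl))) (+-identityʳ c)
∑-point (suc n) (suc k₀) c (s<s k₀<n) = ∑-point n k₀ c k₀<n

erase : (ℕ → ℕ) → ℕ → ℕ → ℕ
erase f k₀ k = if k ≡ᵇ k₀ then 0 else f k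

∑-erase : ∀ n k₀ (f : ℕ → ℕ) → k₀ < n → ∑ n f ≡ ∑ n (erase f k₀) + f k₀
∑-erase n k₀ f k₀<n = begin
  ∑ n f                                                    ≡⟨ ∑-cong n (λ k _ → split k) ⟩
  ∑[ k < n ] (erase f k₀ k + (if k ≡ᵇ k₀ then f k₀ else 0)) ≡⟨ ∑-distrib-+ n (erase f k₀) _ ⟩
  ∑ n (erase f k₀) + ∑[ k < n ] (if k ≡ᵇ k₀ then f k₀ else 0) ≡⟨ cong (∑ n (erase f k₀) +_) (∑-point n k₀ (f k₀) k₀<n) ⟩
  ∑ n (erase f k₀) + f k₀                                  ∎
  where
  open ≡-Reasoning
  split : ∀ k → f k ≡ erase f k₀ k + (if k ≡ᵇ k₀ then f k₀ else 0)
  split k with k ≡ᵇ k₀ in eq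
  ... | true  = cong f (≡ᵇ-true⇒≡ k k₀ eq)
  ... | false = sym (+-identityʳ (f k))

⟦⟧≤1 : ∀ b → ⟦ b ⟧ ≤ 1
⟦⟧≤1 true  = ≤-refl
⟦⟧≤1 false = z≤n

⟦∧⟧ : ∀ a b → ⟦ a ∧ b ⟧ ≡ ⟦ a ⟧ * ⟦ b ⟧
⟦∧⟧ true  b = sym (+-identityʳ _)
⟦∧⟧ false b = refl

any< : ℕ → (ℕ → Bool) → Bool
any< zero    q = false
any< (suc n) q = q 0 ∨ any< n (q ∘ suc)

⟦any<⟧ : ∀ n (q : ℕ → Bool) → ∑[ k < n ] ⟦ q k ⟧ ≤ 1 → ⟦ any< n q ⟧ ≡ ∑[ k < n ] ⟦ q k ⟧
⟦any<⟧ zero    q _  = refl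
⟦any<⟧ (suc n) q ≤1 with q 0
... | false = ⟦any<⟧ n (q ∘ suc) ≤1
... | true  = cong suc (sym (n≤0⇒n≡0 (+-cancelˡ-≤ 1 _ _ ≤1)))

⟦any<-∧⟧ : ∀ n (w q : ℕ → Bool) → ∑[ k < n ] ⟦ w k ⟧ ≤ 1 →
  ⟦ any< n (λ k → w k ∧ q k) ⟧ ≡ ∑[ k < n ] (⟦ w k ⟧ * ⟦ q k ⟧)
⟦any<-∧⟧ n w q ≤1 = trans (⟦any<⟧ n _ (≤-trans (∑-mono-≤ n (λ k _ → ∧≤ (w k) (q k))) ≤1))
                         (∑-cong n (λ k _ → ⟦∧⟧ (w k) (q k)))
  where ∧≤ : ∀ a b → ⟦ a ∧ b ⟧ ≤ ⟦ a ⟧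
        ∧≤ true  b = ⟦⟧≤1 b
        ∧≤ false b = z≤n

∑-weighted-≡0 : ∀ n (w : ℕ → Bool) (x : ℕ → ℕ) → ∑[ k < n ] ⟦ w k ⟧ ≡ 0 → ∑[ k < n ] (⟦ w k ⟧ * x k) ≡ 0
∑-weighted-≡0 zero    w x _  = refl
∑-weighted-≡0 (suc n) w x eq with w 0
... | false = ∑-weighted-≡0 n (w ∘ suc) (x ∘ suc) eq

map-∑-selection : ∀ n (w : ℕ → Bool) (x θ : ℕ → ℕ) → θ 0 ≡ 0 → ∑[ k < n ] ⟦ w k ⟧ ≤ 1 →
  θ (∑[ k < n ] (⟦ w k ⟧ * x k)) ≡ ∑[ k < n ] (⟦ w k ⟧ * θ (x k))
map-∑-selection zero    w x θ θ0 _  = θ0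
map-∑-selection (suc n) w x θ θ0 ≤1 with w 0
... | false = map-∑-selection n (w ∘ suc) (x ∘ suc) θ θ0 ≤1
... | true  = trans (cong θ (only (x 0) (x ∘ suc))) (sym (only (θ (x 0)) (θ ∘ x ∘ suc)))
  where
  only : ∀ v y → v + 0 + ∑[ k < n ] (⟦ w (suc k) ⟧ * y k) ≡ v
  only v y = trans (cong (v + 0 +_) (∑-weighted-≡0 n (w ∘ suc) y (n≤0⇒n≡0 (+-cancelˡ-≤ 1 _ _ ≤1))))
                   (trans (+-identityʳ _) (+-identityʳ v))

-- Matchings of equal weights

record Matching (α β : ℕ) (f g : ℕ → ℕ) : Set where
  infix 7 _~_
  field
    _~_      : ℕ → ℕ → Bool
    ~-sound  : ∀ x y → x ~ y ≡ true → x < α × y < β × f x ≡ g y × 0 < f x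
    matchedˡ : ∀ x → x < α → 0 < f x → ∑[ y < β ] ⟦ x ~ y ⟧ ≡ 1
    matchedʳ : ∀ y → y < β → 0 < g y → ∑[ x < α ] ⟦ x ~ y ⟧ ≡ 1

transpose : ∀ {α β f g} → Matching α β f g → Matching β α g f
transpose M = record
  { _~_      = λ y x → x ~ y
  ; ~-sound  = λ y x eq → let x<α , y<β , fx≡gy , fx>0 = ~-sound x y eq
                         in y<β , x<α , sym fx≡gy , subst (0 <_) fx≡gy fx>0
  ; matchedˡ = matchedʳ
  ; matchedʳ = matchedˡ
  }
  where open Matching M

record SameProfile (α β : ℕ) (f g : ℕ → ℕ) : Set where
  constructor sameProfile
  field
    counts≥ : ∀ l → ∑[ x < α ] ⟦ suc l ≤ᵇ f x ⟧ ≡ ∑[ y < β ] ⟦ suc l ≤ᵇ g y ⟧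
open SameProfile

∑-level : ∀ n (f : ℕ → ℕ) v →
  ∑[ x < n ] ⟦ suc v ≤ᵇ f x ⟧ ≡ ∑[ x < n ] ⟦ suc (suc v) ≤ᵇ f x ⟧ + ∑[ x < n ] ⟦ f x ≡ᵇ suc v ⟧
∑-level n f v = trans (∑-cong n (λ x _ → level v (f x))) (∑-distrib-+ n _ _)
  where
  level : ∀ v x → ⟦ suc v ≤ᵇ x ⟧ ≡ ⟦ suc (suc v) ≤ᵇ x ⟧ + ⟦ x ≡ᵇ suc v ⟧
  level v       zero          = refl
  level zero    (suc zero)    = refl
  level zero    (suc (suc x)) = refl
  level (suc v) (suc x)       = level v x

sameProfile⇒sameLevels : ∀ {α β f g} → SameProfile α β f g → ∀ v →
  ∑[ x < α ] ⟦ f x ≡ᵇ suc v ⟧ ≡ ∑[ y < β ] ⟦ g y ≡ᵇ suc v ⟧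
sameProfile⇒sameLevels {α} {β} {f} {g} P v = +-cancelˡ-≡ (∑[ x < α ] ⟦ suc (suc v) ≤ᵇ f x ⟧) _ _ (begin
  ∑[ x < α ] ⟦ suc (suc v) ≤ᵇ f x ⟧ + ∑[ x < α ] ⟦ f x ≡ᵇ suc v ⟧ ≡⟨ ∑-level α f v ⟨
  ∑[ x < α ] ⟦ suc v ≤ᵇ f x ⟧                                     ≡⟨ counts≥ P v ⟩
  ∑[ y < β ] ⟦ suc v ≤ᵇ g y ⟧                                     ≡⟨ ∑-level β g v ⟩
  ∑[ y < β ] ⟦ suc (suc v) ≤ᵇ g y ⟧ + ∑[ y < β ] ⟦ g y ≡ᵇ suc v ⟧ ≡⟨ cong (_+ _) (counts≥ P (suc v)) ⟨
  ∑[ x < α ] ⟦ suc (suc v) ≤ᵇ f x ⟧ + ∑[ y < β ] ⟦ g y ≡ᵇ suc v ⟧ ∎)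
  where open ≡-Reasoning

matching-empty : ∀ {β f g} → (∀ y → y < β → g y ≡ 0) → Matching 0 β f g
matching-empty g≡0 = record
  { _~_      = λ _ _ → false
  ; ~-sound  = λ _ _ ()
  ; matchedˡ = λ _ ()
  ; matchedʳ = λ y y<β gy>0 → ⊥-elim (<-irrefl (sym (g≡0 y y<β)) gy>0)
  }

matching-skip : ∀ {α β f g} → f 0 ≡ 0 → Matching α β (f ∘ suc) g → Matching (suc α) β f g
matching-skip f0≡0 M = record
  { _~_      = λ { zero _ → false ; (suc x) y → x ~ y }
  ; ~-sound  = λ { zero _ () ; (suc x) y eq → let x<α , rest = ~-sound x y eq in s<s x<α , rest }
  ; matchedˡ = λ { zero _ f0>0 → ⊥-elim (<-irrefl (sym f0≡0) f0>0)
                 ; (suc x) (s<s x<α) fx>0 → matchedˡ x x<α fx>0 }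
  ; matchedʳ = matchedʳ
  }
  where open Matching M

erase-pos : ∀ (g : ℕ → ℕ) y₀ y → 0 < erase g y₀ y → erase g y₀ y ≡ g y
erase-pos g y₀ y pos with y ≡ᵇ y₀
... | false = refl

matching-extend : ∀ {α β f g} y₀ → y₀ < β → f 0 ≡ g y₀ → 0 < f 0 →
  Matching α β (f ∘ suc) (erase g y₀) → Matching (suc α) β f g
matching-extend {α} {β} {f} {g} y₀ y₀<β f0≡gy₀ f0>0 M = record
  { _~_ = _~′_ ; ~-sound = sound ; matchedˡ = matchedˡ′ ; matchedʳ = matchedʳ′ }
  where
  open Matching M
  _~′_ : ℕ → ℕ → Bool
  zero  ~′ y = y ≡ᵇ y₀
  suc x ~′ y = x ~ y

  sound : ∀ x y → x ~′ y ≡ true → x < suc α × y < β × f x ≡ g y × 0 < f x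
  sound zero    y eq rewrite ≡ᵇ-true⇒≡ y y₀ eq = z<s , y₀<β , f0≡gy₀ , f0>0
  sound (suc x) y eq = let x<α , y<β , fx≡gy , fx>0 = ~-sound x y eq
                       in s<s x<α , y<β , trans fx≡gy (erase-pos g y₀ y (subst (0 <_) fx≡gy fx>0)) , fx>0

  matchedˡ′ : ∀ x → x < suc α → 0 < f x → ∑[ y < β ] ⟦ x ~′ y ⟧ ≡ 1
  matchedˡ′ zero    _         _    = ∑-point β y₀ 1 y₀<β
  matchedˡ′ (suc x) (s<s x<α) fx>0 = matchedˡ x x<α fx>0

  y₀-free : ∀ x → x ~ y₀ ≡ false
  y₀-free x with x ~ y₀ in eq
  ... | false = refl
  ... | true  = let _ , _ , fx≡0 , fx>0 = ~-sound x y₀ eq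
                in ⊥-elim (<-irrefl (sym (trans fx≡0 erased)) fx>0)
    where erased : erase g y₀ y₀ ≡ 0
          erased rewrite ≡ᵇ-refl y₀ = refl

  matchedʳ′ : ∀ y → y < β → 0 < g y → ∑[ x < suc α ] ⟦ x ~′ y ⟧ ≡ 1
  matchedʳ′ y y<β gy>0 with y ≡ᵇ y₀ in eq
  ... | true rewrite ≡ᵇ-true⇒≡ y y₀ eq = cong suc (∑-≡0 α (λ x _ → cong ⟦_⟧ (y₀-free x)))
  ... | false = matchedʳ y y<β (subst (0 <_) (sym gy≡) gy>0)
    where gy≡ : erase g y₀ y ≡ g y
          gy≡ rewrite eq = refl

sameProfile-empty : ∀ {β f g} → SameProfile 0 β f g → ∀ y → y < β → g y ≡ 0
sameProfile-empty {β} {g = g} P y y<β with g y in eq | term≤∑ β (λ y → ⟦ 1 ≤ᵇ g y ⟧) y y<β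
... | zero  | _  = refl
... | suc _ | le with subst (1 ≤_) (sym (counts≥ P 0)) le
... | ()

sameProfile-skip : ∀ {α β f g} → SameProfile (suc α) β f g → f 0 ≡ 0 → SameProfile α β (f ∘ suc) g
sameProfile-skip {α} {f = f} P f0≡0 =
  sameProfile λ l → trans (cong (λ z → ⟦ suc l ≤ᵇ z ⟧ + ∑[ x < α ] ⟦ suc l ≤ᵇ f (suc x) ⟧) (sym f0≡0)) (counts≥ P l)

sameProfile-erase : ∀ {α β f g} y₀ → SameProfile (suc α) β f g → y₀ < β → g y₀ ≡ f 0 →
  SameProfile α β (f ∘ suc) (erase g y₀)
sameProfile-erase {α} {β} {f} {g} y₀ P y₀<β gy₀≡f0 = sameProfile counts
  where
  open ≡-Reasoning
  erase-level : ∀ l y → erase (λ y → ⟦ suc l ≤ᵇ g y ⟧) y₀ y ≡ ⟦ suc l ≤ᵇ erase g y₀ y ⟧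
  erase-level l y with y ≡ᵇ y₀
  ... | true  = refl
  ... | false = refl
  counts : ∀ l → ∑[ x < α ] ⟦ suc l ≤ᵇ f (suc x) ⟧ ≡ ∑[ y < β ] ⟦ suc l ≤ᵇ erase g y₀ y ⟧
  counts l = +-cancelˡ-≡ (level (f 0)) _ _ (begin
    level (f 0) + ∑[ x < α ] level (f (suc x))  ≡⟨ counts≥ P l ⟩
    ∑ β (level ∘ g)                             ≡⟨ ∑-erase β y₀ (level ∘ g) y₀<β ⟩
    ∑ β (erase (level ∘ g) y₀) + level (g y₀)   ≡⟨ +-comm _ (level (g y₀)) ⟩
    level (g y₀) + ∑ β (erase (level ∘ g) y₀)   ≡⟨ cong₂ _+_ (cong level gy₀≡f0) (∑-cong β (λ y _ → erase-level l y)) ⟩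
    level (f 0) + ∑ β (level ∘ erase g y₀)      ∎)
    where level : ℕ → ℕ
          level z = ⟦ suc l ≤ᵇ z ⟧

⟦⟧-pos : ∀ {b} → 0 < ⟦ b ⟧ → b ≡ true
⟦⟧-pos {true} _ = refl

sameProfile⇒partner : ∀ {α β f g} → SameProfile (suc α) β f g → ∀ {v} → f 0 ≡ suc v →
  Σ ℕ λ y → y < β × g y ≡ suc v
sameProfile⇒partner {α} {β} {f} {g} P {v} f0≡1+v
  with ∑-pos⇒term-pos β _ (subst (0 <_) (sameProfile⇒sameLevels P v) count>0)
  where count>0 : 0 < ∑[ x < suc α ] ⟦ f x ≡ᵇ suc v ⟧
        count>0 rewrite f0≡1+v | ≡ᵇ-refl v = z<s
... | y , y<β , pos = y , y<β , ≡ᵇ-true⇒≡ (g y) (suc v) (⟦⟧-pos pos)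

matching : ∀ α {β f g} → SameProfile α β f g → Matching α β f g
matching zero    P = matching-empty (sameProfile-empty P)
matching (suc α) {f = f} P with f 0 in f0
... | zero  = matching-skip f0 (matching α (sameProfile-skip P f0))
... | suc v with sameProfile⇒partner P f0
... | y₀ , y₀<β , gy₀ = matching-extend y₀ y₀<β (trans f0 (sym gy₀)) (subst (0 <_) (sym f0) z<s)
                          (matching α (sameProfile-erase y₀ P y₀<β (trans gy₀ (sym f0))))

sameProfile-bounded : ∀ Δ {α β f g} → (∀ x → x < α → f x ≤ Δ) → (∀ y → y < β → g y ≤ Δ) →
  (∀ (l : Fin Δ) → ∑[ x < α ] ⟦ suc (toℕ l) ≤ᵇ f x ⟧ ≡ ∑[ y < β ] ⟦ suc (toℕ l) ≤ᵇ g y ⟧) →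
  SameProfile α β f g
sameProfile-bounded Δ {α} {β} {f} {g} f≤Δ g≤Δ counts = sameProfile counts′
  where
  above : ∀ {v l} → v ≤ Δ → ¬ l < Δ → ⟦ suc l ≤ᵇ v ⟧ ≡ 0
  above {v} {l} v≤Δ l≮Δ with suc l ≤ᵇ v in eq
  ... | false = refl
  ... | true  = ⊥-elim (l≮Δ (<-≤-trans (≤ᵇ⇒≤ (suc l) v (subst T (sym eq) _)) v≤Δ))
  counts′ : ∀ l → ∑[ x < α ] ⟦ suc l ≤ᵇ f x ⟧ ≡ ∑[ y < β ] ⟦ suc l ≤ᵇ g y ⟧
  counts′ l with l <? Δ
  ... | yes l<Δ = subst (λ l → ∑[ x < α ] ⟦ suc l ≤ᵇ f x ⟧ ≡ ∑[ y < β ] ⟦ suc l ≤ᵇ g y ⟧)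
                        (Finₚ.toℕ-fromℕ< l<Δ) (counts (fromℕ< l<Δ))
  ... | no  l≮Δ = trans (∑-≡0 α (λ x x<α → above (f≤Δ x x<α) l≮Δ)) (sym (∑-≡0 β (λ y y<β → above (g≤Δ y y<β) l≮Δ)))

module MatchingProperties {α β f g} (M : Matching α β f g) where
  open Matching M

  ~-false : ∀ x y → ¬ (x < α × 0 < f x) → x ~ y ≡ false
  ~-false x y unmatched with x ~ y in eq
  ... | false = refl
  ... | true  = let x<α , _ , _ , fx>0 = ~-sound x y eq in ⊥-elim (unmatched (x<α , fx>0))

  empty-row : ∀ {x} → ¬ (x < α × 0 < f x) → ∑[ y < β ] ⟦ x ~ y ⟧ ≡ 0
  empty-row {x} unmatched = ∑-≡0 β (λ y _ → cong ⟦_⟧ (~-false x y unmatched))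

  row≤1 : ∀ x → ∑[ y < β ] ⟦ x ~ y ⟧ ≤ 1
  row≤1 x with x <? α | 0 <? f x
  ... | yes x<α | yes fx>0 = ≤-reflexive (matchedˡ x x<α fx>0)
  ... | yes _   | no  fx≯0 = subst (_≤ 1) (sym (empty-row λ (_ , fx>0) → fx≯0 fx>0)) z≤n
  ... | no  x≮α | _        = subst (_≤ 1) (sym (empty-row λ (x<α , _) → x≮α x<α)) z≤n

  row-pos⇒weight-pos : ∀ x (v : ℕ → ℕ) → 0 < ∑[ y < β ] (⟦ x ~ y ⟧ * v y) → 0 < f x
  row-pos⇒weight-pos x v pos with ∑-pos⇒term-pos β _ pos
  ... | y , _ , term>0 with x ~ y in eq
  ... | true = let _ , _ , _ , fx>0 = ~-sound x y eq in fx>0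

  ∑-row-weight : ∀ x → x < α → ∑[ y < β ] (⟦ x ~ y ⟧ * g y) ≡ f x
  ∑-row-weight x x<α = trans (∑-cong β (λ y _ → partner-weight y)) (trans (∑-distribʳ-* β (f x) _) row*fx)
    where
    partner-weight : ∀ y → ⟦ x ~ y ⟧ * g y ≡ ⟦ x ~ y ⟧ * f x
    partner-weight y with x ~ y in eq
    ... | false = refl
    ... | true  = let _ , _ , fx≡gy , _ = ~-sound x y eq in cong (1 *_) (sym fx≡gy)
    row*fx : ∑[ y < β ] ⟦ x ~ y ⟧ * f x ≡ f x
    row*fx with f x in eq
    ... | zero  = *-zeroʳ (∑[ y < β ] ⟦ x ~ y ⟧)
    ... | suc _ = trans (cong (_* _) (matchedˡ x x<α (subst (0 <_) (sym eq) z<s))) (*-identityˡ _)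

  ∑∑-matched : ∀ (v : ℕ → ℕ) → (∀ y → y < β → 0 < v y → 0 < g y) →
    ∑[ x < α ] ∑[ y < β ] (⟦ x ~ y ⟧ * v y) ≡ ∑ β v
  ∑∑-matched v supp = trans (∑-comm α β _) (∑-cong β column)
    where
    column : ∀ y → y < β → ∑[ x < α ] (⟦ x ~ y ⟧ * v y) ≡ v y
    column y y<β with v y in eq
    ... | zero  = ∑-≡0 α (λ x _ → *-zeroʳ ⟦ x ~ y ⟧)
    ... | suc _ = trans (∑-distribʳ-* α _ _)
                    (trans (cong (_* _) (matchedʳ y y<β (supp y y<β (subst (0 <_) (sym eq) z<s)))) (*-identityˡ _))

-- Dags as forward relations on ℕ

sum-tabulate : ∀ n (F : Fin n → ℕ) (F′ : ℕ → ℕ) → (∀ x → F x ≡ F′ (toℕ x)) →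
  sum (List.tabulate F) ≡ ∑ n F′
sum-tabulate zero    F F′ eq = refl
sum-tabulate (suc n) F F′ eq = cong₂ _+_ (eq Fin.zero) (sum-tabulate n (F ∘ Fin.suc) (F′ ∘ suc) (eq ∘ Fin.suc))

countF≡∑ : ∀ {n} (q : Fin n → Bool) (Q : ℕ → Bool) → (∀ x → q x ≡ Q (toℕ x)) →
  countF q ≡ ∑[ k < n ] ⟦ Q k ⟧
countF≡∑ {n} q Q eq = trans (cong sum (Listₚ.map-tabulate (λ x → x) (λ k → ⟦ q k ⟧)))
                            (sum-tabulate n _ _ (λ x → cong ⟦_⟧ (eq x)))

Represents : ∀ {N} → TopDag N → (ℕ → ℕ → Bool) → Set
Represents G g = ∀ x y → arc G x y ≡ g (toℕ x) (toℕ y)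

arcℕ : ∀ {N} → TopDag N → ℕ → ℕ → Bool
arcℕ {N} G u v with u <? N | v <? N
... | yes u<N | yes v<N = arc G (fromℕ< u<N) (fromℕ< v<N)
... | _       | _       = false

arcℕ-represents : ∀ {N} (G : TopDag N) → Represents G (arcℕ G)
arcℕ-represents {N} G x y with toℕ x <? N | toℕ y <? N
... | yes x<N | yes y<N = cong₂ (arc G) (sym (Finₚ.fromℕ<-toℕ x x<N)) (sym (Finₚ.fromℕ<-toℕ y y<N))
... | no  x≮N | _       = ⊥-elim (x≮N (Finₚ.toℕ<n x))
... | yes _   | no  y≮N = ⊥-elim (y≮N (Finₚ.toℕ<n y))

arcℕ-forward : ∀ {N} (G : TopDag N) u v → arcℕ G u v ≡ true → u < v
arcℕ-forward {N} G u v arc≡true with u <? N | v <? N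
... | yes u<N | yes v<N = subst₂ _<_ (Finₚ.toℕ-fromℕ< u<N) (Finₚ.toℕ-fromℕ< v<N) (forward G _ _ arc≡true)

fromArcs : ∀ N (g : ℕ → ℕ → Bool) → (∀ u v → g u v ≡ true → u < v) → TopDag N
fromArcs N g fwd = record { arc = λ x y → g (toℕ x) (toℕ y) ; forward = λ x y → fwd (toℕ x) (toℕ y) }

module _ {N} (G : TopDag N) (g : ℕ → ℕ → Bool) (G≈g : Represents G g) where

  indeg≡∑ : ∀ x → indeg G x ≡ ∑[ u < N ] ⟦ g u (toℕ x) ⟧
  indeg≡∑ x = countF≡∑ (λ u → arc G u x) _ (λ u → G≈g u x)

  outdeg≡∑ : ∀ x → outdeg G x ≡ ∑[ v < N ] ⟦ g (toℕ x) v ⟧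
  outdeg≡∑ x = countF≡∑ (arc G x) _ (G≈g x)

outdegInto : (ℕ → ℕ → Bool) → ℕ → ℕ → ℕ → ℕ
outdegInto g κ ρ k = ∑[ t < ρ ] ⟦ g k (κ + t) ⟧

-- Before position κ every neighbour at or after κ is an out-neighbour, since arcs go forward.
pot-lookup : ∀ Δ {N} (G : TopDag N) g → Represents G g → (∀ u v → g u v ≡ true → u < v) →
  ∀ κ ρ → κ + ρ ≡ N → ∀ l → Vec.lookup (pot Δ G κ) l ≡ ∑[ k < κ ] ⟦ suc (toℕ l) ≤ᵇ outdegInto g κ ρ k ⟧
pot-lookup Δ G g G≈g fwd κ ρ refl l = begin
  Vec.lookup (pot Δ G κ) l                                       ≡⟨ Vecₚ.lookup∘tabulate _ l ⟩
  countF (λ k → (toℕ k <ᵇ κ) ∧ (suc (toℕ l) ≤ᵇ nbrsAfter G κ k)) ≡⟨ countF≡∑ _ counted (λ x → cong (counted′ (toℕ x)) (nbrs≡ x)) ⟩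
  ∑ (κ + ρ) (⟦_⟧ ∘ counted)                                       ≡⟨ ∑-split κ ρ _ ⟩
  ∑ κ (⟦_⟧ ∘ counted) + ∑[ t < ρ ] ⟦ counted (κ + t) ⟧            ≡⟨ cong₂ _+_ (∑-cong κ before) (∑-≡0 ρ after) ⟩
  ∑[ k < κ ] ⟦ suc (toℕ l) ≤ᵇ outdegInto g κ ρ k ⟧ + 0           ≡⟨ +-identityʳ _ ⟩
  ∑[ k < κ ] ⟦ suc (toℕ l) ≤ᵇ outdegInto g κ ρ k ⟧               ∎
  where
  open ≡-Reasoning
  nbrs : ℕ → ℕ
  nbrs k = ∑[ v < κ + ρ ] ⟦ (κ ≤ᵇ v) ∧ (g k v ∨ g v k) ⟧
  counted′ : ℕ → ℕ → Bool
  counted′ k d = (k <ᵇ κ) ∧ (suc (toℕ l) ≤ᵇ d)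
  counted : ℕ → Bool
  counted k = counted′ k (nbrs k)
  nbrs≡ : ∀ x → nbrsAfter G κ x ≡ nbrs (toℕ x)
  nbrs≡ x = countF≡∑ _ _ (λ y → cong₂ (λ a b → (κ ≤ᵇ toℕ y) ∧ (a ∨ b)) (G≈g x y) (G≈g y x))
  nbrs-before : ∀ k → k < κ → nbrs k ≡ outdegInto g κ ρ k
  nbrs-before k k<κ = trans (∑-split κ ρ _) (cong₂ _+_ (∑-≡0 κ early) (∑-cong ρ late))
    where
    early : ∀ v → v < κ → ⟦ (κ ≤ᵇ v) ∧ (g k v ∨ g v k) ⟧ ≡ 0
    early v v<κ with κ ≤ᵇ v in eq
    ... | false = refl
    ... | true  = ⊥-elim (<⇒≱ v<κ (≤ᵇ⇒≤ κ v (subst T (sym eq) _)))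
    late : ∀ t → t < ρ → ⟦ (κ ≤ᵇ κ + t) ∧ (g k (κ + t) ∨ g (κ + t) k) ⟧ ≡ ⟦ g k (κ + t) ⟧
    late t _ with κ ≤ᵇ κ + t in eq₁ | g (κ + t) k in eq₂
    ... | false | _     = ⊥-elim (subst T eq₁ (≤⇒≤ᵇ (m≤m+n κ t)))
    ... | true  | false = cong ⟦_⟧ (∨-identityʳ _)
    ... | true  | true  = ⊥-elim (<⇒≱ (fwd _ _ eq₂) (≤-trans (<⇒≤ k<κ) (m≤m+n κ t)))
  before : ∀ k → k < κ → ⟦ counted k ⟧ ≡ ⟦ suc (toℕ l) ≤ᵇ outdegInto g κ ρ k ⟧
  before k k<κ with k <ᵇ κ in eq
  ... | true  = cong (λ d → ⟦ suc (toℕ l) ≤ᵇ d ⟧) (nbrs-before k k<κ)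
  ... | false = ⊥-elim (subst T eq (<⇒<ᵇ k<κ))
  after : ∀ t → t < ρ → ⟦ counted (κ + t) ⟧ ≡ 0
  after t _ with κ + t <ᵇ κ in eq
  ... | false = refl
  ... | true  = ⊥-elim (<⇒≱ (<ᵇ⇒< _ _ (subst T (sym eq) _)) (m≤m+n κ t))

elemAt : List Elem → ℕ → Elem
elemAt []       _       = 0 , 0
elemAt (e ∷ _)  zero    = e
elemAt (_ ∷ es) (suc k) = elemAt es k

lookup≡elemAt : ∀ (es : List Elem) (x : Fin (length es)) → lookup es x ≡ elemAt es (toℕ x)
lookup≡elemAt (e ∷ es) Fin.zero    = refl
lookup≡elemAt (e ∷ es) (Fin.suc x) = lookup≡elemAt es x

elemAt-++ˡ : ∀ (xs ys : List Elem) k → k < length xs → elemAt (xs ++ ys) k ≡ elemAt xs k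
elemAt-++ˡ (x ∷ xs) ys zero    _         = refl
elemAt-++ˡ (x ∷ xs) ys (suc k) (s<s k<n) = elemAt-++ˡ xs ys k k<n

elemAt-++ʳ : ∀ (xs ys : List Elem) k → elemAt (xs ++ ys) (length xs + k) ≡ elemAt ys k
elemAt-++ʳ []       ys k = refl
elemAt-++ʳ (x ∷ xs) ys k = elemAt-++ʳ xs ys k

elemAt-take : ∀ i (xs : List Elem) k → k < i → elemAt (take i xs) k ≡ elemAt xs k
elemAt-take (suc i) []       k       _         = refl
elemAt-take (suc i) (x ∷ xs) zero    _         = refl
elemAt-take (suc i) (x ∷ xs) (suc k) (s<s k<i) = elemAt-take i xs k k<i

elemAt-drop : ∀ i (xs : List Elem) k → elemAt (drop i xs) k ≡ elemAt xs (i + k)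
elemAt-drop zero    xs       k = refl
elemAt-drop (suc i) []       k = refl
elemAt-drop (suc i) (x ∷ xs) k = elemAt-drop i xs k

All-elemAt : ∀ {P : Elem → Set} {es} → All P es → ∀ k → k < length es → P (elemAt es k)
All-elemAt (px ∷ _)   zero    _         = px
All-elemAt (_  ∷ pxs) (suc k) (s<s k<n) = All-elemAt pxs k k<n

∑-elemAt : ∀ (es : List Elem) (F : Elem → ℕ) → ∑[ k < length es ] F (elemAt es k) ≡ sum (map F es)
∑-elemAt []       F = refl
∑-elemAt (e ∷ es) F = cong (F e +_) (∑-elemAt es F)

++-cancelʳ-↭ : ∀ {xs ys : List Elem} zs → xs ++ zs ↭ ys ++ zs → xs ↭ ys
++-cancelʳ-↭ {xs} {ys} []       p = ↭-trans (↭-sym (↭ₚ.++-identityʳ xs)) (↭-trans p (↭ₚ.++-identityʳ ys))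
++-cancelʳ-↭ {xs} {ys} (z ∷ zs) p = ++-cancelʳ-↭ zs (↭ₚ.drop-mid xs ys p)

↭-middle : ∀ {xs ys zs us vs ws : List Elem} → xs ↭ us → zs ↭ ws → xs ++ ys ++ zs ↭ vs ++ us ++ ws → ys ↭ vs
↭-middle {xs} {ys} {zs} {us} {vs} {ws} xs↭us zs↭ws p = ++-cancelʳ-↭ (xs ++ zs) (↭-trans rotate (↭-trans p restore))
  where
  rotate : ys ++ xs ++ zs ↭ xs ++ ys ++ zs
  rotate = ↭-trans (↭ₚ.++-comm ys (xs ++ zs))
             (↭-trans (↭-reflexive (Listₚ.++-assoc xs zs ys)) (↭ₚ.++⁺ˡ xs (↭ₚ.++-comm zs ys)))
  restore : vs ++ us ++ ws ↭ vs ++ xs ++ zs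
  restore = ↭ₚ.++⁺ˡ vs (↭ₚ.++⁺ (↭-sym xs↭us) (↭-sym zs↭ws))

module Realization {es : List Elem} {G : TopDag (length es)} (real : Realizes es G) where

  indeg-at : ∀ k → k < length es → ∑[ u < length es ] ⟦ arcℕ G u k ⟧ ≡ proj₁ (elemAt es k)
  indeg-at k k<n = subst (λ k → ∑[ u < length es ] ⟦ arcℕ G u k ⟧ ≡ proj₁ (elemAt es k)) (Finₚ.toℕ-fromℕ< k<n)
    (trans (sym (indeg≡∑ G (arcℕ G) (arcℕ-represents G) x)) (trans (proj₁ (real x)) (cong proj₁ (lookup≡elemAt es x))))
    where x = fromℕ< k<n

  outdeg-at : ∀ k → k < length es → ∑[ v < length es ] ⟦ arcℕ G k v ⟧ ≡ proj₂ (elemAt es k)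
  outdeg-at k k<n = subst (λ k → ∑[ v < length es ] ⟦ arcℕ G k v ⟧ ≡ proj₂ (elemAt es k)) (Finₚ.toℕ-fromℕ< k<n)
    (trans (sym (outdeg≡∑ G (arcℕ G) (arcℕ-represents G) x)) (trans (proj₂ (real x)) (cong proj₂ (lookup≡elemAt es x))))
    where x = fromℕ< k<n

realizes-fromArcs : ∀ (es : List Elem) (g : ℕ → ℕ → Bool) (fwd : ∀ u v → g u v ≡ true → u < v) →
  (∀ k → k < length es → ∑[ u < length es ] ⟦ g u k ⟧ ≡ proj₁ (elemAt es k)) →
  (∀ k → k < length es → ∑[ v < length es ] ⟦ g k v ⟧ ≡ proj₂ (elemAt es k)) →
  Realizes es (fromArcs (length es) g fwd)
realizes-fromArcs es g fwd indeg-at outdeg-at x =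
  trans (indeg≡∑ (fromArcs (length es) g fwd) g G≈g x) (trans (indeg-at (toℕ x) (Finₚ.toℕ<n x)) (cong proj₁ (sym (lookup≡elemAt es x)))) ,
  trans (outdeg≡∑ (fromArcs (length es) g fwd) g G≈g x) (trans (outdeg-at (toℕ x) (Finₚ.toℕ<n x)) (cong proj₂ (sym (lookup≡elemAt es x))))
  where G≈g : Represents (fromArcs (length es) g fwd) g
        G≈g _ _ = refl

-- Splicing

<-+-view : ∀ a m z → z < a + m → z < a ⊎ Σ ℕ λ y → z ≡ a + y × y < m
<-+-view a m z z<a+m with z <? a
... | yes z<a = inj₁ z<a
... | no  z≮a = inj₂ (z ∸ a , sym a+y≡z , +-cancelˡ-< a _ _ (subst (_< a + m) (sym a+y≡z) z<a+m))
  where a+y≡z = m+[n∸m]≡n (≮⇒≥ z≮a)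

data Slot : Set where
  pre mid post : ℕ → Slot
  beyond : Slot

-- g is a dag on φ, cut after position i (|φ| = i + r), and h a dag on ψ = A φ' B
-- (|A| = a, |φ'| = m, |B| = b) without arcs into A.
module Splice (i m r a b : ℕ) (g h : ℕ → ℕ → Bool)
  (g-fwd : ∀ u v → g u v ≡ true → u < v)
  (h-fwd : ∀ u v → h u v ≡ true → u < v)
  (h-sources : ∀ x x′ → x′ < a → h x x′ ≡ false)
  where

  outdegH : ℕ → ℕ
  outdegH x = ∑[ v < a + (m + b) ] ⟦ h x v ⟧

  crossing : ℕ → ℕ
  crossing = outdegInto g i r

  intoSinks : ℕ → ℕ
  intoSinks = outdegInto h (a + m) b

  g-back : ∀ u v → v ≤ u → g u v ≡ false
  g-back u v v≤u with g u v in eq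
  ... | false = refl
  ... | true  = ⊥-elim (<⇒≱ (g-fwd u v eq) v≤u)

  h-back : ∀ u v → v ≤ u → h u v ≡ false
  h-back u v v≤u with h u v in eq
  ... | false = refl
  ... | true  = ⊥-elim (<⇒≱ (h-fwd u v eq) v≤u)

  outdegH-split : ∀ z → outdegH z ≡ ∑[ y < m ] ⟦ h z (a + y) ⟧ + intoSinks z
  outdegH-split z = begin
    outdegH z                                                                      ≡⟨ ∑-split₃ a m b _ ⟩
    ∑[ x < a ] ⟦ h z x ⟧ + (∑[ y < m ] ⟦ h z (a + y) ⟧ + ∑[ s < b ] ⟦ h z (a + (m + s)) ⟧)
      ≡⟨ cong₂ _+_ (∑-≡0 a (λ x x<a → cong ⟦_⟧ (h-sources z x x<a)))
                   (cong (∑[ y < m ] ⟦ h z (a + y) ⟧ +_) (∑-cong b (λ s _ → cong (⟦_⟧ ∘ h z) (sym (+-assoc a m s))))) ⟩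
    ∑[ y < m ] ⟦ h z (a + y) ⟧ + intoSinks z                                       ∎
    where open ≡-Reasoning

  intoSinks≤outdegH : ∀ z → intoSinks z ≤ outdegH z
  intoSinks≤outdegH z = subst (intoSinks z ≤_) (sym (outdegH-split z)) (m≤n+m (intoSinks z) _)

  locate : ℕ → Slot
  locate k with k <? i
  ... | yes _ = pre k
  ... | no  _ with k ∸ i <? m
  ...   | yes _ = mid (k ∸ i)
  ...   | no  _ with k ∸ i ∸ m <? r
  ...     | yes _ = post (k ∸ i ∸ m)
  ...     | no  _ = beyond

  locate-pre : ∀ u → u < i → locate u ≡ pre u
  locate-pre u u<i with u <? i
  ... | yes _   = refl
  ... | no  u≮i = ⊥-elim (u≮i u<i)

  locate-mid : ∀ y → y < m → locate (i + y) ≡ mid y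
  locate-mid y y<m with i + y <? i
  ... | yes i+y<i = ⊥-elim (<⇒≱ i+y<i (m≤m+n i y))
  ... | no  _ with i + y ∸ i <? m | m+n∸m≡n i y
  ...   | yes _   | eq = cong mid eq
  ...   | no  y≮m | eq = ⊥-elim (y≮m (subst (_< m) (sym eq) y<m))

  locate-post : ∀ t → t < r → locate (i + (m + t)) ≡ post t
  locate-post t t<r with i + (m + t) <? i
  ... | yes k<i = ⊥-elim (<⇒≱ k<i (m≤m+n i (m + t)))
  ... | no  _ with i + (m + t) ∸ i <? m | m+n∸m≡n i (m + t)
  ...   | yes p | eq = ⊥-elim (<⇒≱ (subst (_< m) eq p) (m≤m+n m t))
  ...   | no  _ | eq with i + (m + t) ∸ i ∸ m <? r | trans (cong (_∸ m) eq) (m+n∸m≡n m t)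
  ...     | yes _   | eq′ = cong post eq′
  ...     | no  t≮r | eq′ = ⊥-elim (t≮r (subst (_< r) (sym eq′) t<r))

  locate⁻¹ : ∀ k → (∀ {u} → locate k ≡ pre u → k ≡ u × u < i)
                 × (∀ {y} → locate k ≡ mid y → k ≡ i + y × y < m)
                 × (∀ {t} → locate k ≡ post t → k ≡ i + (m + t))
  locate⁻¹ k with k <? i
  ... | yes k<i = (λ { refl → refl , k<i }) , (λ ()) , (λ ())
  ... | no  k≮i with k ∸ i <? m
  ...   | yes k∸i<m = (λ ()) , (λ { refl → sym (m+[n∸m]≡n (≮⇒≥ k≮i)) , k∸i<m }) , (λ ())
  ...   | no  k∸i≮m with k ∸ i ∸ m <? r
  ...     | yes _ = (λ ()) , (λ ()) , λ { refl → sym (trans (cong (i +_) (m+[n∸m]≡n (≮⇒≥ k∸i≮m))) (m+[n∸m]≡n (≮⇒≥ k≮i))) }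
  ...     | no  _ = (λ ()) , (λ ()) , (λ ())

  module Matched (T : Matching a i outdegH crossing) (R : Matching (a + m) i intoSinks crossing) where
    open Matching T using () renaming (_~_ to _~ᵀ_)
    open Matching R using () renaming (_~_ to _~ᴿ_)
    module Tᵀ = MatchingProperties (transpose T)
    module Rₚ = MatchingProperties R

    -- Positions are 0-based: pre u is entry u of φ (u < i), mid y entry y of φ', post t entry i + t of φ.
    slotArc : Slot → Slot → Bool
    slotArc (pre u)  (pre v)   = g u v
    slotArc (pre u)  (mid y)   = any< a (λ x → x ~ᵀ u ∧ h x (a + y))
    slotArc (pre u)  (post t)  = any< a (λ x → x ~ᵀ u ∧ any< i (λ w → x ~ᴿ w ∧ g w (i + t)))
    slotArc (mid y)  (mid y′)  = h (a + y) (a + y′)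
    slotArc (mid y)  (post t)  = any< i (λ w → (a + y) ~ᴿ w ∧ g w (i + t))
    slotArc (post t) (post t′) = g (i + t) (i + t′)
    slotArc _        _         = false

    spliced : ℕ → ℕ → Bool
    spliced u v = slotArc (locate u) (locate v)

    spliced-fwd : ∀ u v → spliced u v ≡ true → u < v
    spliced-fwd u v arc≡true with locate u in eu | locate v in ev | arc≡true
    ... | pre u′ | pre v′ | e
      with refl , _ ← proj₁ (locate⁻¹ u) eu | refl , _ ← proj₁ (locate⁻¹ v) ev = g-fwd u v e
    ... | pre u′ | mid y | _
      with refl , u<i ← proj₁ (locate⁻¹ u) eu | refl , _ ← proj₁ (proj₂ (locate⁻¹ v)) ev = <-≤-trans u<i (m≤m+n i y)
    ... | pre u′ | post t | _
      with refl , u<i ← proj₁ (locate⁻¹ u) eu | refl ← proj₂ (proj₂ (locate⁻¹ v)) ev = <-≤-trans u<i (m≤m+n i (m + t))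
    ... | mid y | mid y′ | e
      with refl , _ ← proj₁ (proj₂ (locate⁻¹ u)) eu | refl , _ ← proj₁ (proj₂ (locate⁻¹ v)) ev =
        +-monoʳ-< i (+-cancelˡ-< a y y′ (h-fwd _ _ e))
    ... | mid y | post t | _
      with refl , y<m ← proj₁ (proj₂ (locate⁻¹ u)) eu | refl ← proj₂ (proj₂ (locate⁻¹ v)) ev =
        +-monoʳ-< i (<-≤-trans y<m (m≤m+n m t))
    ... | post t | post t′ | e
      with refl ← proj₂ (proj₂ (locate⁻¹ u)) eu | refl ← proj₂ (proj₂ (locate⁻¹ v)) ev =
        +-monoʳ-< i (+-monoʳ-< m (+-cancelˡ-< i t t′ (g-fwd _ _ e)))
    ... | pre _  | beyond | ()
    ... | mid _  | pre _  | ()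
    ... | mid _  | beyond | ()
    ... | post _ | pre _  | ()
    ... | post _ | mid _  | ()
    ... | post _ | beyond | ()
    ... | beyond | _      | ()

    arc-pre-pre : ∀ u v → u < i → v < i → spliced u v ≡ g u v
    arc-pre-pre u v u<i v<i rewrite locate-pre u u<i | locate-pre v v<i = refl

    arc-pre-mid : ∀ u y → u < i → y < m → ⟦ spliced u (i + y) ⟧ ≡ ∑[ x < a ] (⟦ x ~ᵀ u ⟧ * ⟦ h x (a + y) ⟧)
    arc-pre-mid u y u<i y<m rewrite locate-pre u u<i | locate-mid y y<m = ⟦any<-∧⟧ a (_~ᵀ u) _ (Tᵀ.row≤1 u)

    arc-pre-post : ∀ u t → u < i → t < r → ⟦ spliced u (i + (m + t)) ⟧ ≡
      ∑[ x < a ] (⟦ x ~ᵀ u ⟧ * ∑[ w < i ] (⟦ x ~ᴿ w ⟧ * ⟦ g w (i + t) ⟧))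
    arc-pre-post u t u<i t<r rewrite locate-pre u u<i | locate-post t t<r =
      trans (⟦any<-∧⟧ a (_~ᵀ u) _ (Tᵀ.row≤1 u))
            (∑-cong a (λ x _ → cong (⟦ x ~ᵀ u ⟧ *_) (⟦any<-∧⟧ i (x ~ᴿ_) _ (Rₚ.row≤1 x))))

    arc-mid-pre : ∀ y v → y < m → v < i → spliced (i + y) v ≡ false
    arc-mid-pre y v y<m v<i rewrite locate-mid y y<m | locate-pre v v<i = refl

    arc-mid-mid : ∀ y y′ → y < m → y′ < m → spliced (i + y) (i + y′) ≡ h (a + y) (a + y′)
    arc-mid-mid y y′ y<m y′<m rewrite locate-mid y y<m | locate-mid y′ y′<m = refl

    arc-mid-post : ∀ y t → y < m → t < r → ⟦ spliced (i + y) (i + (m + t)) ⟧ ≡ ∑[ w < i ] (⟦ (a + y) ~ᴿ w ⟧ * ⟦ g w (i + t) ⟧)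
    arc-mid-post y t y<m t<r rewrite locate-mid y y<m | locate-post t t<r = ⟦any<-∧⟧ i ((a + y) ~ᴿ_) _ (Rₚ.row≤1 (a + y))

    arc-post-pre : ∀ t v → t < r → v < i → spliced (i + (m + t)) v ≡ false
    arc-post-pre t v t<r v<i rewrite locate-post t t<r | locate-pre v v<i = refl

    arc-post-mid : ∀ t y → t < r → y < m → spliced (i + (m + t)) (i + y) ≡ false
    arc-post-mid t y t<r y<m rewrite locate-post t t<r | locate-mid y y<m = refl

    arc-post-post : ∀ t t′ → t < r → t′ < r → spliced (i + (m + t)) (i + (m + t′)) ≡ g (i + t) (i + t′)
    arc-post-post t t′ t<r t′<r rewrite locate-post t t<r | locate-post t′ t′<r = refl

    N : ℕ
    N = i + (m + r)

    arc-into-mid⇒source : ∀ x y → y < m → 0 < ⟦ h x (a + y) ⟧ → 0 < outdegH x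
    arc-into-mid⇒source x y y<m pos =
      <-≤-trans pos (term≤∑ (a + (m + b)) (⟦_⟧ ∘ h x) (a + y) (+-monoʳ-< a (<-≤-trans y<m (m≤m+n m b))))

    R-row⇒source : ∀ x (v : ℕ → ℕ) → 0 < ∑[ w < i ] (⟦ x ~ᴿ w ⟧ * v w) → 0 < outdegH x
    R-row⇒source x v pos = <-≤-trans (Rₚ.row-pos⇒weight-pos x v pos) (intoSinks≤outdegH x)

    arc-into-post⇒crossing : ∀ w t → t < r → 0 < ⟦ g w (i + t) ⟧ → 0 < crossing w
    arc-into-post⇒crossing w t t<r pos = <-≤-trans pos (term≤∑ r (λ t → ⟦ g w (i + t) ⟧) t t<r)

    indeg-pre : ∀ v → v < i → ∑[ u < N ] ⟦ spliced u v ⟧ ≡ ∑[ u < i + r ] ⟦ g u v ⟧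
    indeg-pre v v<i = begin
      ∑[ u < N ] ⟦ spliced u v ⟧ ≡⟨ ∑-split₃ i m r _ ⟩
      ∑[ u < i ] ⟦ spliced u v ⟧ + (∑[ y < m ] ⟦ spliced (i + y) v ⟧ + ∑[ t < r ] ⟦ spliced (i + (m + t)) v ⟧)
        ≡⟨ cong₂ _+_ (∑-cong i (λ u u<i → cong ⟦_⟧ (arc-pre-pre u v u<i v<i)))
             (cong₂ _+_ (∑-≡0 m (λ y y<m → cong ⟦_⟧ (arc-mid-pre y v y<m v<i)))
                        (∑-≡0 r (λ t t<r → cong ⟦_⟧ (arc-post-pre t v t<r v<i)))) ⟩
      ∑[ u < i ] ⟦ g u v ⟧ + 0
        ≡⟨ cong (∑[ u < i ] ⟦ g u v ⟧ +_) (sym (∑-≡0 r (λ t _ → cong ⟦_⟧ (g-back (i + t) v (≤-trans (<⇒≤ v<i) (m≤m+n i t)))))) ⟩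
      ∑[ u < i ] ⟦ g u v ⟧ + ∑[ t < r ] ⟦ g (i + t) v ⟧ ≡⟨ ∑-split i r _ ⟨
      ∑[ u < i + r ] ⟦ g u v ⟧ ∎
      where open ≡-Reasoning

    indeg-mid : ∀ y → y < m → ∑[ u < N ] ⟦ spliced u (i + y) ⟧ ≡ ∑[ u < a + (m + b) ] ⟦ h u (a + y) ⟧
    indeg-mid y y<m = begin
      ∑[ u < N ] ⟦ spliced u (i + y) ⟧ ≡⟨ ∑-split₃ i m r _ ⟩
      ∑[ u < i ] ⟦ spliced u (i + y) ⟧ + (∑[ y′ < m ] ⟦ spliced (i + y′) (i + y) ⟧ + ∑[ t < r ] ⟦ spliced (i + (m + t)) (i + y) ⟧)
        ≡⟨ cong₂ _+_ (∑-cong i (λ u u<i → arc-pre-mid u y u<i y<m))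
             (cong₂ _+_ (∑-cong m (λ y′ y′<m → cong ⟦_⟧ (arc-mid-mid y′ y y′<m y<m)))
                        (∑-≡0 r (λ t t<r → cong ⟦_⟧ (arc-post-mid t y t<r y<m)))) ⟩
      ∑[ u < i ] ∑[ x < a ] (⟦ x ~ᵀ u ⟧ * ⟦ h x (a + y) ⟧) + (∑[ y′ < m ] ⟦ h (a + y′) (a + y) ⟧ + 0)
        ≡⟨ cong₂ _+_ (Tᵀ.∑∑-matched (λ x → ⟦ h x (a + y) ⟧) (λ x _ → arc-into-mid⇒source x y y<m))
             (cong (∑[ y′ < m ] ⟦ h (a + y′) (a + y) ⟧ +_) (sym (∑-≡0 b (λ s _ → cong ⟦_⟧ (h-back _ _ later))))) ⟩
      ∑[ x < a ] ⟦ h x (a + y) ⟧ + (∑[ y′ < m ] ⟦ h (a + y′) (a + y) ⟧ + ∑[ s < b ] ⟦ h (a + (m + s)) (a + y) ⟧)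
        ≡⟨ ∑-split₃ a m b _ ⟨
      ∑[ u < a + (m + b) ] ⟦ h u (a + y) ⟧ ∎
      where
      open ≡-Reasoning
      later : ∀ {s} → a + y ≤ a + (m + s)
      later {s} = +-monoʳ-≤ a (≤-trans (<⇒≤ y<m) (m≤m+n m s))

    indeg-post : ∀ t → t < r → ∑[ u < N ] ⟦ spliced u (i + (m + t)) ⟧ ≡ ∑[ u < i + r ] ⟦ g u (i + t) ⟧
    indeg-post t t<r = begin
      ∑[ u < N ] ⟦ spliced u (i + (m + t)) ⟧ ≡⟨ ∑-split₃ i m r _ ⟩
      ∑[ u < i ] ⟦ spliced u (i + (m + t)) ⟧ + (∑[ y < m ] ⟦ spliced (i + y) (i + (m + t)) ⟧ + ∑[ t′ < r ] ⟦ spliced (i + (m + t′)) (i + (m + t)) ⟧)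
        ≡⟨ cong₂ _+_ (∑-cong i (λ u u<i → arc-pre-post u t u<i t<r))
             (cong₂ _+_ (∑-cong m (λ y y<m → arc-mid-post y t y<m t<r))
                        (∑-cong r (λ t′ t′<r → cong ⟦_⟧ (arc-post-post t′ t t′<r t<r)))) ⟩
      ∑[ u < i ] ∑[ x < a ] (⟦ x ~ᵀ u ⟧ * via x) + (∑[ y < m ] via (a + y) + ∑[ t′ < r ] ⟦ g (i + t′) (i + t) ⟧)
        ≡⟨ cong (_+ (∑[ y < m ] via (a + y) + ∑[ t′ < r ] ⟦ g (i + t′) (i + t) ⟧)) (Tᵀ.∑∑-matched via (λ x _ → R-row⇒source x _)) ⟩
      ∑[ x < a ] via x + (∑[ y < m ] via (a + y) + ∑[ t′ < r ] ⟦ g (i + t′) (i + t) ⟧)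
        ≡⟨ +-assoc (∑ a via) _ _ ⟨
      (∑[ x < a ] via x + ∑[ y < m ] via (a + y)) + ∑[ t′ < r ] ⟦ g (i + t′) (i + t) ⟧
        ≡⟨ cong (_+ ∑[ t′ < r ] ⟦ g (i + t′) (i + t) ⟧) (trans (sym (∑-split a m via)) (Rₚ.∑∑-matched (λ w → ⟦ g w (i + t) ⟧) (λ w _ → arc-into-post⇒crossing w t t<r))) ⟩
      ∑[ w < i ] ⟦ g w (i + t) ⟧ + ∑[ t′ < r ] ⟦ g (i + t′) (i + t) ⟧ ≡⟨ ∑-split i r _ ⟨
      ∑[ u < i + r ] ⟦ g u (i + t) ⟧ ∎
      where
      open ≡-Reasoning
      via : ℕ → ℕ
      via z = ∑[ w < i ] (⟦ z ~ᴿ w ⟧ * ⟦ g w (i + t) ⟧)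

    redirected≡intoSinks : ∀ z → z < a + m → ∑[ t < r ] ∑[ w < i ] (⟦ z ~ᴿ w ⟧ * ⟦ g w (i + t) ⟧) ≡ intoSinks z
    redirected≡intoSinks z z<a+m =
      trans (∑∑-distribˡ-* r i (λ w → ⟦ z ~ᴿ w ⟧) (λ w t → ⟦ g w (i + t) ⟧)) (Rₚ.∑-row-weight z z<a+m)

    outdeg-pre : ∀ u → u < i → ∑[ v < N ] ⟦ spliced u v ⟧ ≡ ∑[ v < i + r ] ⟦ g u v ⟧
    outdeg-pre u u<i = begin
      ∑[ v < N ] ⟦ spliced u v ⟧ ≡⟨ ∑-split₃ i m r _ ⟩
      ∑[ v < i ] ⟦ spliced u v ⟧ + (∑[ y < m ] ⟦ spliced u (i + y) ⟧ + ∑[ t < r ] ⟦ spliced u (i + (m + t)) ⟧)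
        ≡⟨ cong₂ _+_ (∑-cong i (λ v v<i → cong ⟦_⟧ (arc-pre-pre u v u<i v<i)))
             (cong₂ _+_ (∑-cong m (λ y y<m → arc-pre-mid u y u<i y<m)) (∑-cong r (λ t t<r → arc-pre-post u t u<i t<r))) ⟩
      ∑[ v < i ] ⟦ g u v ⟧ + (∑[ y < m ] ∑[ x < a ] (⟦ x ~ᵀ u ⟧ * ⟦ h x (a + y) ⟧)
                             + ∑[ t < r ] ∑[ x < a ] (⟦ x ~ᵀ u ⟧ * ∑[ w < i ] (⟦ x ~ᴿ w ⟧ * ⟦ g w (i + t) ⟧)))
        ≡⟨ cong (∑[ v < i ] ⟦ g u v ⟧ +_) (cong₂ _+_ (∑∑-distribˡ-* m a (λ x → ⟦ x ~ᵀ u ⟧) (λ x y → ⟦ h x (a + y) ⟧))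
             (∑∑-distribˡ-* r a (λ x → ⟦ x ~ᵀ u ⟧) (λ x t → ∑[ w < i ] (⟦ x ~ᴿ w ⟧ * ⟦ g w (i + t) ⟧)))) ⟩
      ∑[ v < i ] ⟦ g u v ⟧ + (∑[ x < a ] (⟦ x ~ᵀ u ⟧ * ∑[ y < m ] ⟦ h x (a + y) ⟧)
                             + ∑[ x < a ] (⟦ x ~ᵀ u ⟧ * ∑[ t < r ] ∑[ w < i ] (⟦ x ~ᴿ w ⟧ * ⟦ g w (i + t) ⟧)))
        ≡⟨ cong (∑[ v < i ] ⟦ g u v ⟧ +_) (trans (sym (∑-distrib-+ a _ _)) (∑-cong a source-out)) ⟩
      ∑[ v < i ] ⟦ g u v ⟧ + ∑[ x < a ] (⟦ x ~ᵀ u ⟧ * outdegH x)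
        ≡⟨ cong (∑[ v < i ] ⟦ g u v ⟧ +_) (Tᵀ.∑-row-weight u u<i) ⟩
      ∑[ v < i ] ⟦ g u v ⟧ + crossing u ≡⟨ ∑-split i r _ ⟨
      ∑[ v < i + r ] ⟦ g u v ⟧ ∎
      where
      open ≡-Reasoning
      source-out : ∀ x → x < a → ⟦ x ~ᵀ u ⟧ * ∑[ y < m ] ⟦ h x (a + y) ⟧
                                 + ⟦ x ~ᵀ u ⟧ * ∑[ t < r ] ∑[ w < i ] (⟦ x ~ᴿ w ⟧ * ⟦ g w (i + t) ⟧) ≡ ⟦ x ~ᵀ u ⟧ * outdegH x
      source-out x x<a = trans (sym (*-distribˡ-+ ⟦ x ~ᵀ u ⟧ _ _))
        (cong (⟦ x ~ᵀ u ⟧ *_) (trans (cong (∑[ y < m ] ⟦ h x (a + y) ⟧ +_) (redirected≡intoSinks x (<-≤-trans x<a (m≤m+n a m))))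
                                     (sym (outdegH-split x))))

    outdeg-mid : ∀ y → y < m → ∑[ v < N ] ⟦ spliced (i + y) v ⟧ ≡ ∑[ v < a + (m + b) ] ⟦ h (a + y) v ⟧
    outdeg-mid y y<m = begin
      ∑[ v < N ] ⟦ spliced (i + y) v ⟧ ≡⟨ ∑-split₃ i m r _ ⟩
      ∑[ v < i ] ⟦ spliced (i + y) v ⟧ + (∑[ y′ < m ] ⟦ spliced (i + y) (i + y′) ⟧ + ∑[ t < r ] ⟦ spliced (i + y) (i + (m + t)) ⟧)
        ≡⟨ cong₂ _+_ (∑-≡0 i (λ v v<i → cong ⟦_⟧ (arc-mid-pre y v y<m v<i)))
             (cong₂ _+_ (∑-cong m (λ y′ y′<m → cong ⟦_⟧ (arc-mid-mid y y′ y<m y′<m))) (∑-cong r (λ t t<r → arc-mid-post y t y<m t<r))) ⟩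
      ∑[ y′ < m ] ⟦ h (a + y) (a + y′) ⟧ + ∑[ t < r ] ∑[ w < i ] (⟦ (a + y) ~ᴿ w ⟧ * ⟦ g w (i + t) ⟧)
        ≡⟨ cong (∑[ y′ < m ] ⟦ h (a + y) (a + y′) ⟧ +_) (redirected≡intoSinks (a + y) (+-monoʳ-< a y<m)) ⟩
      ∑[ y′ < m ] ⟦ h (a + y) (a + y′) ⟧ + intoSinks (a + y) ≡⟨ outdegH-split (a + y) ⟨
      ∑[ v < a + (m + b) ] ⟦ h (a + y) v ⟧ ∎
      where open ≡-Reasoning

    outdeg-post : ∀ t → t < r → ∑[ v < N ] ⟦ spliced (i + (m + t)) v ⟧ ≡ ∑[ v < i + r ] ⟦ g (i + t) v ⟧
    outdeg-post t t<r = begin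
      ∑[ v < N ] ⟦ spliced (i + (m + t)) v ⟧ ≡⟨ ∑-split₃ i m r _ ⟩
      ∑[ v < i ] ⟦ spliced (i + (m + t)) v ⟧ + (∑[ y < m ] ⟦ spliced (i + (m + t)) (i + y) ⟧ + ∑[ t′ < r ] ⟦ spliced (i + (m + t)) (i + (m + t′)) ⟧)
        ≡⟨ cong₂ _+_ (∑-≡0 i (λ v v<i → cong ⟦_⟧ (arc-post-pre t v t<r v<i)))
             (cong₂ _+_ (∑-≡0 m (λ y y<m → cong ⟦_⟧ (arc-post-mid t y t<r y<m)))
                        (∑-cong r (λ t′ t′<r → cong ⟦_⟧ (arc-post-post t t′ t<r t′<r)))) ⟩
      ∑[ t′ < r ] ⟦ g (i + t) (i + t′) ⟧
        ≡⟨ cong (_+ ∑[ t′ < r ] ⟦ g (i + t) (i + t′) ⟧) (sym (∑-≡0 i (λ v v<i → cong ⟦_⟧ (g-back (i + t) v (≤-trans (<⇒≤ v<i) (m≤m+n i t)))))) ⟩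
      ∑[ v < i ] ⟦ g (i + t) v ⟧ + ∑[ t′ < r ] ⟦ g (i + t) (i + t′) ⟧ ≡⟨ ∑-split i r _ ⟨
      ∑[ v < i + r ] ⟦ g (i + t) v ⟧ ∎
      where open ≡-Reasoning

    module Window (q ρ : ℕ) (q+ρ≡r : q + ρ ≡ r) where

      κ : ℕ
      κ = i + (m + q)

      crossingBeyond : ℕ → ℕ
      crossingBeyond w = ∑[ t < ρ ] ⟦ g w (i + (q + t)) ⟧

      q+t<r : ∀ t → t < ρ → q + t < r
      q+t<r t t<ρ = subst (q + t <_) q+ρ≡r (+-monoʳ-< q t<ρ)

      κ+t : ∀ t → κ + t ≡ i + (m + (q + t))
      κ+t t = trans (+-assoc i (m + q) t) (cong (i +_) (+-assoc m q t))

      crossingBeyond≤crossing : ∀ w → crossingBeyond w ≤ crossing w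
      crossingBeyond≤crossing w = subst (crossingBeyond w ≤_)
        (trans (sym (∑-split q ρ (λ t → ⟦ g w (i + t) ⟧))) (cong (λ n → ∑[ t < n ] ⟦ g w (i + t) ⟧) q+ρ≡r))
        (m≤n+m (crossingBeyond w) _)

      window-pre : ∀ u → u < i →
        outdegInto spliced κ ρ u ≡ ∑[ x < a ] (⟦ x ~ᵀ u ⟧ * ∑[ w < i ] (⟦ x ~ᴿ w ⟧ * crossingBeyond w))
      window-pre u u<i = begin
        ∑[ t < ρ ] ⟦ spliced u (κ + t) ⟧
          ≡⟨ ∑-cong ρ (λ t t<ρ → trans (cong (⟦_⟧ ∘ spliced u) (κ+t t)) (arc-pre-post u (q + t) u<i (q+t<r t t<ρ))) ⟩
        ∑[ t < ρ ] ∑[ x < a ] (⟦ x ~ᵀ u ⟧ * ∑[ w < i ] (⟦ x ~ᴿ w ⟧ * ⟦ g w (i + (q + t)) ⟧))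
          ≡⟨ ∑∑-distribˡ-* ρ a (λ x → ⟦ x ~ᵀ u ⟧) _ ⟩
        ∑[ x < a ] (⟦ x ~ᵀ u ⟧ * ∑[ t < ρ ] ∑[ w < i ] (⟦ x ~ᴿ w ⟧ * ⟦ g w (i + (q + t)) ⟧))
          ≡⟨ ∑-cong a (λ x _ → cong (⟦ x ~ᵀ u ⟧ *_) (∑∑-distribˡ-* ρ i (λ w → ⟦ x ~ᴿ w ⟧) _)) ⟩
        ∑[ x < a ] (⟦ x ~ᵀ u ⟧ * ∑[ w < i ] (⟦ x ~ᴿ w ⟧ * crossingBeyond w)) ∎
        where open ≡-Reasoning

      window-mid : ∀ y → y < m → outdegInto spliced κ ρ (i + y) ≡ ∑[ w < i ] (⟦ (a + y) ~ᴿ w ⟧ * crossingBeyond w)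
      window-mid y y<m =
        trans (∑-cong ρ (λ t t<ρ → trans (cong (⟦_⟧ ∘ spliced (i + y)) (κ+t t)) (arc-mid-post y (q + t) y<m (q+t<r t t<ρ))))
              (∑∑-distribˡ-* ρ i (λ w → ⟦ (a + y) ~ᴿ w ⟧) _)

      window-post : ∀ t′ → t′ < q → outdegInto spliced κ ρ (i + (m + t′)) ≡ crossingBeyond (i + t′)
      window-post t′ t′<q = ∑-cong ρ (λ t t<ρ → cong ⟦_⟧ (trans (cong (spliced (i + (m + t′))) (κ+t t))
        (arc-post-post t′ (q + t) (<-≤-trans t′<q (subst (q ≤_) q+ρ≡r (m≤m+n q ρ))) (q+t<r t t<ρ))))

      -- A vertex before the window sees it through its partners, which are unique, so θ passes through the selections.
      ∑-window : ∀ (θ : ℕ → ℕ) → θ 0 ≡ 0 →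
        ∑[ k < κ ] θ (outdegInto spliced κ ρ k) ≡ ∑[ k < i + q ] θ (outdegInto g (i + q) ρ k)
      ∑-window θ θ0 = begin
        ∑[ k < κ ] θ (outdegInto spliced κ ρ k) ≡⟨ ∑-split₃ i m q _ ⟩
        ∑[ u < i ] θ (outdegInto spliced κ ρ u) + (∑[ y < m ] θ (outdegInto spliced κ ρ (i + y))
                                                  + ∑[ t′ < q ] θ (outdegInto spliced κ ρ (i + (m + t′))))
          ≡⟨ cong₂ _+_ (∑-cong i θ-pre) (cong₂ _+_ (∑-cong m θ-mid) (∑-cong q (λ t′ t′<q → cong θ (window-post t′ t′<q)))) ⟩
        ∑[ u < i ] ∑[ x < a ] (⟦ x ~ᵀ u ⟧ * via x) + (∑[ y < m ] via (a + y) + ∑[ t′ < q ] θ (crossingBeyond (i + t′)))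
          ≡⟨ cong (_+ (∑[ y < m ] via (a + y) + ∑[ t′ < q ] θ (crossingBeyond (i + t′))))
                  (Tᵀ.∑∑-matched via (λ x _ → R-row⇒source x _)) ⟩
        ∑[ x < a ] via x + (∑[ y < m ] via (a + y) + ∑[ t′ < q ] θ (crossingBeyond (i + t′)))
          ≡⟨ +-assoc (∑ a via) _ _ ⟨
        (∑[ x < a ] via x + ∑[ y < m ] via (a + y)) + ∑[ t′ < q ] θ (crossingBeyond (i + t′))
          ≡⟨ cong (_+ ∑[ t′ < q ] θ (crossingBeyond (i + t′))) (trans (sym (∑-split a m via)) (Rₚ.∑∑-matched (θ ∘ crossingBeyond) supp)) ⟩
        ∑[ w < i ] θ (crossingBeyond w) + ∑[ t′ < q ] θ (crossingBeyond (i + t′)) ≡⟨ ∑-split i q _ ⟨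
        ∑[ k < i + q ] θ (crossingBeyond k)
          ≡⟨ ∑-cong (i + q) (λ k _ → cong θ (∑-cong ρ (λ t _ → cong (⟦_⟧ ∘ g k) (sym (+-assoc i q t))))) ⟩
        ∑[ k < i + q ] θ (outdegInto g (i + q) ρ k) ∎
        where
        open ≡-Reasoning
        via : ℕ → ℕ
        via x = ∑[ w < i ] (⟦ x ~ᴿ w ⟧ * θ (crossingBeyond w))
        θ-pre : ∀ u → u < i → θ (outdegInto spliced κ ρ u) ≡ ∑[ x < a ] (⟦ x ~ᵀ u ⟧ * via x)
        θ-pre u u<i = trans (cong θ (window-pre u u<i))
          (trans (map-∑-selection a (_~ᵀ u) _ θ θ0 (Tᵀ.row≤1 u))
                 (∑-cong a (λ x _ → cong (⟦ x ~ᵀ u ⟧ *_) (map-∑-selection i (x ~ᴿ_) crossingBeyond θ θ0 (Rₚ.row≤1 x)))))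
        θ-mid : ∀ y → y < m → θ (outdegInto spliced κ ρ (i + y)) ≡ via (a + y)
        θ-mid y y<m = trans (cong θ (window-mid y y<m)) (map-∑-selection i ((a + y) ~ᴿ_) crossingBeyond θ θ0 (Rₚ.row≤1 (a + y)))
        supp : ∀ w → w < i → 0 < θ (crossingBeyond w) → 0 < crossing w
        supp w _ pos = <-≤-trans (θ-pos (crossingBeyond w) pos) (crossingBeyond≤crossing w)
          where θ-pos : ∀ n → 0 < θ n → 0 < n
                θ-pos zero    pos = ⊥-elim (<-irrefl (sym θ0) pos)
                θ-pos (suc n) _   = z<s

-- Insertion

module Insertion (Δ : ℕ) .{{_ : NonZero Δ}} {S S′ : DegSeq}
  (S-bounded : All (Bounded Δ) S) (S′-bounded : All (Bounded Δ) S′)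
  (φ : List Elem) (G : TopDag (length φ)) (φ↭S : φ ↭ S) (G-realizes : Realizes φ G)
  (φ′ : List Elem) (p : Pot Δ) (Ps : DegSeq) (Ps-valid : IsPs Δ p Ps) (A B : List Elem)
  (A↭Ps : A ↭ Ps) (B↭Pt : B ↭ Pt p) (H : TopDag (length (A ++ φ′ ++ B)))
  (ψ↭ : A ++ φ′ ++ B ↭ S′ ++ Ps ++ Pt p) (H-realizes : Realizes (A ++ φ′ ++ B) H)
  (potH : pot Δ H (length A + length φ′) ≡ p)
  (i : ℕ) (i≤n : i ≤ length φ) (potG : pot Δ G i ≡ p)
  where

  n m a b r : ℕ
  n = length φ
  m = length φ′
  a = length A
  b = length B
  r = n ∸ i

  ψ φ″ : List Elem
  ψ  = A ++ φ′ ++ B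
  φ″ = take i φ ++ φ′ ++ drop i φ

  g h : ℕ → ℕ → Bool
  g = arcℕ G
  h = arcℕ H

  i+r≡n : i + r ≡ n
  i+r≡n = m+[n∸m]≡n i≤n

  |ψ| : length ψ ≡ a + (m + b)
  |ψ| = trans (Listₚ.length-++ A) (cong (a +_) (Listₚ.length-++ φ′))

  |take| : length (take i φ) ≡ i
  |take| = trans (Listₚ.length-take i φ) (m≤n⇒m⊓n≡m i≤n)

  |φ″| : length φ″ ≡ i + (m + r)
  |φ″| = trans (Listₚ.length-++ (take i φ))
               (cong₂ _+_ |take| (trans (Listₚ.length-++ φ′) (cong (m +_) (Listₚ.length-drop i φ))))

  module Gₚ = Realization {φ} {G} G-realizes
  module Hₚ = Realization {ψ} {H} H-realizes

  φ′↭S′ : φ′ ↭ S′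
  φ′↭S′ = ↭-middle A↭Ps B↭Pt ψ↭

  A-sources : All (λ e → (proj₁ e ≡ 0) × (proj₂ e ≤ Δ)) A
  A-sources = ↭ₚ.All-resp-↭ (↭-sym A↭Ps) (proj₁ (proj₂ Ps-valid))

  φ-bounded : All (Bounded Δ) φ
  φ-bounded = ↭ₚ.All-resp-↭ (↭-sym φ↭S) S-bounded

  φ′-bounded : All (Bounded Δ) φ′
  φ′-bounded = ↭ₚ.All-resp-↭ (↭-sym φ′↭S′) S′-bounded

  <ψ : ∀ z → z < a + (m + b) → z < length ψ
  <ψ z z<ψ = subst (z <_) (sym |ψ|) z<ψ

  <ψ-mid : ∀ y → y < m → a + y < length ψ
  <ψ-mid y y<m = <ψ (a + y) (+-monoʳ-< a (<-≤-trans y<m (m≤m+n m b)))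

  ψ-source : ∀ x → x < a → elemAt ψ x ≡ elemAt A x
  ψ-source x x<a = elemAt-++ˡ A (φ′ ++ B) x x<a

  ψ-mid : ∀ y → y < m → elemAt ψ (a + y) ≡ elemAt φ′ y
  ψ-mid y y<m = trans (elemAt-++ʳ A (φ′ ++ B) y) (elemAt-++ˡ φ′ B y y<m)

  h-sources : ∀ x x′ → x′ < a → h x x′ ≡ false
  h-sources x x′ x′<a with h x x′ in eq
  ... | false = refl
  ... | true  = ⊥-elim (<-irrefl refl (subst (1 ≤_) indeg≡0 arc≤indeg))
    where
    x′<ψ : x′ < length ψ
    x′<ψ = <ψ x′ (<-≤-trans x′<a (m≤m+n a (m + b)))
    indeg≡0 : ∑[ u < length ψ ] ⟦ h u x′ ⟧ ≡ 0
    indeg≡0 = trans (Hₚ.indeg-at x′ x′<ψ) (trans (cong proj₁ (ψ-source x′ x′<a)) (proj₁ (All-elemAt A-sources x′ x′<a)))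
    arc≤indeg : 1 ≤ ∑[ u < length ψ ] ⟦ h u x′ ⟧
    arc≤indeg = subst (λ e → ⟦ e ⟧ ≤ ∑[ u < length ψ ] ⟦ h u x′ ⟧) eq
                  (term≤∑ (length ψ) (λ u → ⟦ h u x′ ⟧) x (<-trans (arcℕ-forward H x x′ eq) x′<ψ))

  open Splice i m r a b g h (arcℕ-forward G) (arcℕ-forward H) h-sources

  outdegH-source : ∀ x → x < a → outdegH x ≡ proj₂ (elemAt A x)
  outdegH-source x x<a = trans (cong (λ N → ∑[ v < N ] ⟦ h x v ⟧) (sym |ψ|))
    (trans (Hₚ.outdeg-at x (<ψ x (<-≤-trans x<a (m≤m+n a (m + b))))) (cong proj₂ (ψ-source x x<a)))

  outdegH-mid : ∀ y → y < m → outdegH (a + y) ≡ proj₂ (elemAt φ′ y)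
  outdegH-mid y y<m = trans (cong (λ N → ∑[ v < N ] ⟦ h (a + y) v ⟧) (sym |ψ|))
    (trans (Hₚ.outdeg-at (a + y) (<ψ-mid y y<m)) (cong proj₂ (ψ-mid y y<m)))

  outdegH≤Δ : ∀ z → z < a + m → outdegH z ≤ Δ
  outdegH≤Δ z z<a+m with <-+-view a m z z<a+m
  ... | inj₁ z<a            = subst (_≤ Δ) (sym (outdegH-source z z<a)) (proj₂ (All-elemAt A-sources z z<a))
  ... | inj₂ (y , refl , y<m) = subst (_≤ Δ) (sym (outdegH-mid y y<m)) (proj₂ (All-elemAt φ′-bounded y y<m))

  degG : ∀ u → u < n → ∑[ v < i + r ] ⟦ g v u ⟧ ≡ proj₁ (elemAt φ u) × ∑[ v < i + r ] ⟦ g u v ⟧ ≡ proj₂ (elemAt φ u)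
  degG u u<n = trans (cong (λ N → ∑[ v < N ] ⟦ g v u ⟧) i+r≡n) (Gₚ.indeg-at u u<n) ,
               trans (cong (λ N → ∑[ v < N ] ⟦ g u v ⟧) i+r≡n) (Gₚ.outdeg-at u u<n)

  degH-mid : ∀ y → y < m → ∑[ v < a + (m + b) ] ⟦ h v (a + y) ⟧ ≡ proj₁ (elemAt φ′ y)
                         × ∑[ v < a + (m + b) ] ⟦ h (a + y) v ⟧ ≡ proj₂ (elemAt φ′ y)
  degH-mid y y<m =
    trans (cong (λ N → ∑[ v < N ] ⟦ h v (a + y) ⟧) (sym |ψ|))
          (trans (Hₚ.indeg-at (a + y) (<ψ-mid y y<m)) (cong proj₁ (ψ-mid y y<m))) ,
    outdegH-mid y y<m

  crossing≤Δ : ∀ u → u < i → crossing u ≤ Δ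
  crossing≤Δ u u<i = begin
    crossing u                                    ≤⟨ m≤n+m (crossing u) _ ⟩
    ∑[ v < i ] ⟦ g u v ⟧ + crossing u             ≡⟨ ∑-split i r _ ⟨
    ∑[ v < i + r ] ⟦ g u v ⟧                       ≡⟨ proj₂ (degG u u<n) ⟩
    proj₂ (elemAt φ u)                            ≤⟨ proj₂ (All-elemAt φ-bounded u u<n) ⟩
    Δ                                             ∎
    where open ≤-Reasoning
          u<n = <-≤-trans u<i i≤n

  potG-lookup : ∀ l → Vec.lookup p l ≡ ∑[ u < i ] ⟦ suc (toℕ l) ≤ᵇ crossing u ⟧
  potG-lookup l = trans (cong (λ q → Vec.lookup q l) (sym potG))
                        (pot-lookup Δ G g (arcℕ-represents G) (arcℕ-forward G) i r i+r≡n l)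

  sources-profile : SameProfile a i outdegH crossing
  sources-profile = sameProfile-bounded Δ (λ x x<a → outdegH≤Δ x (<-≤-trans x<a (m≤m+n a m))) crossing≤Δ counts
    where
    counts : ∀ l → ∑[ x < a ] ⟦ suc (toℕ l) ≤ᵇ outdegH x ⟧ ≡ ∑[ u < i ] ⟦ suc (toℕ l) ≤ᵇ crossing u ⟧
    counts l = begin
      ∑[ x < a ] ⟦ suc (toℕ l) ≤ᵇ outdegH x ⟧          ≡⟨ ∑-cong a (λ x x<a → cong atLeast (outdegH-source x x<a)) ⟩
      ∑[ x < a ] atLeast (proj₂ (elemAt A x))          ≡⟨ ∑-elemAt A (atLeast ∘ proj₂) ⟩
      sum (map (atLeast ∘ proj₂) A)                    ≡⟨ sum-↭ (↭ₚ.map⁺ (atLeast ∘ proj₂) A↭Ps) ⟩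
      sum (map (atLeast ∘ proj₂) Ps)                   ≡⟨ ∑-elemAt Ps (atLeast ∘ proj₂) ⟨
      ∑[ k < length Ps ] atLeast (proj₂ (elemAt Ps k)) ≡⟨ countF≡∑ _ _ (λ k → cong (λ e → suc (toℕ l) ≤ᵇ proj₂ e) (lookup≡elemAt Ps k)) ⟨
      countF (λ k → suc (toℕ l) ≤ᵇ proj₂ (lookup Ps k)) ≡⟨ proj₂ (proj₂ Ps-valid) l ⟩
      Vec.lookup p l                                   ≡⟨ potG-lookup l ⟩
      ∑[ u < i ] ⟦ suc (toℕ l) ≤ᵇ crossing u ⟧          ∎
      where open ≡-Reasoning
            atLeast : ℕ → ℕ
            atLeast v = ⟦ suc (toℕ l) ≤ᵇ v ⟧

  sinks-profile : SameProfile (a + m) i intoSinks crossing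
  sinks-profile = sameProfile-bounded Δ (λ z z<a+m → ≤-trans (intoSinks≤outdegH z) (outdegH≤Δ z z<a+m)) crossing≤Δ
    λ l → trans (sym (pot-lookup Δ H h (arcℕ-represents H) (arcℕ-forward H) (a + m) b (trans (+-assoc a m b) (sym |ψ|)) l))
                (trans (cong (λ q → Vec.lookup q l) potH) (potG-lookup l))

  open Matched (matching a sources-profile) (matching (a + m) sinks-profile)

  G″ : TopDag (length φ″)
  G″ = fromArcs (length φ″) spliced spliced-fwd

  φ″-pre : ∀ k → k < i → elemAt φ″ k ≡ elemAt φ k
  φ″-pre k k<i = trans (elemAt-++ˡ (take i φ) _ k (subst (k <_) (sym |take|) k<i)) (elemAt-take i φ k k<i)

  φ″-rest : ∀ k → elemAt φ″ (i + k) ≡ elemAt (φ′ ++ drop i φ) k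
  φ″-rest k = trans (cong (λ z → elemAt φ″ (z + k)) (sym |take|)) (elemAt-++ʳ (take i φ) _ k)

  φ″-mid : ∀ y → y < m → elemAt φ″ (i + y) ≡ elemAt φ′ y
  φ″-mid y y<m = trans (φ″-rest y) (elemAt-++ˡ φ′ _ y y<m)

  φ″-post : ∀ t → elemAt φ″ (i + (m + t)) ≡ elemAt φ (i + t)
  φ″-post t = trans (φ″-rest (m + t)) (trans (elemAt-++ʳ φ′ _ t) (elemAt-drop i φ t))

  by-region : ∀ (P : ℕ → Set) → (∀ u → u < i → P u) → (∀ y → y < m → P (i + y)) → (∀ t → t < r → P (i + (m + t))) →
    ∀ k → k < length φ″ → P k
  by-region P Pᵖʳᵉ Pᵐⁱᵈ Pᵖᵒˢᵗ k k<φ″ with <-+-view i (m + r) k (subst (k <_) |φ″| k<φ″)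
  ... | inj₁ k<i = Pᵖʳᵉ k k<i
  ... | inj₂ (y , refl , y<m+r) with <-+-view m r y y<m+r
  ...   | inj₁ y<m              = Pᵐⁱᵈ y y<m
  ...   | inj₂ (t , refl , t<r) = Pᵖᵒˢᵗ t t<r

  <n : ∀ t → t < r → i + t < n
  <n t t<r = subst (i + t <_) i+r≡n (+-monoʳ-< i t<r)

  G″-realizes : Realizes φ″ G″
  G″-realizes = realizes-fromArcs φ″ spliced spliced-fwd
    (by-region (λ k → ∑[ u < length φ″ ] ⟦ spliced u k ⟧ ≡ proj₁ (elemAt φ″ k))
      (λ u u<i → step (trans (indeg-pre u u<i) (trans (proj₁ (degG u (<-≤-trans u<i i≤n))) (cong proj₁ (sym (φ″-pre u u<i))))))
      (λ y y<m → step (trans (indeg-mid y y<m) (trans (proj₁ (degH-mid y y<m)) (cong proj₁ (sym (φ″-mid y y<m))))))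
      (λ t t<r → step (trans (indeg-post t t<r) (trans (proj₁ (degG (i + t) (<n t t<r))) (cong proj₁ (sym (φ″-post t)))))))
    (by-region (λ k → ∑[ v < length φ″ ] ⟦ spliced k v ⟧ ≡ proj₂ (elemAt φ″ k))
      (λ u u<i → step (trans (outdeg-pre u u<i) (trans (proj₂ (degG u (<-≤-trans u<i i≤n))) (cong proj₂ (sym (φ″-pre u u<i))))))
      (λ y y<m → step (trans (outdeg-mid y y<m) (trans (proj₂ (degH-mid y y<m)) (cong proj₂ (sym (φ″-mid y y<m))))))
      (λ t t<r → step (trans (outdeg-post t t<r) (trans (proj₂ (degG (i + t) (<n t t<r))) (cong proj₂ (sym (φ″-post t)))))))
    where
    step : ∀ {F : ℕ → ℕ} {d} → ∑ N F ≡ d → ∑ (length φ″) F ≡ d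
    step {F} = trans (cong (λ N → ∑ N F) |φ″|)

  φ″↭S++S′ : φ″ ↭ S ++ S′
  φ″↭S++S′ = ↭-trans (↭ₚ.++⁺ˡ (take i φ) (↭ₚ.++-comm φ′ (drop i φ)))
    (↭-trans (↭-reflexive (trans (sym (Listₚ.++-assoc (take i φ) (drop i φ) φ′)) (cong (_++ φ′) (Listₚ.take++drop≡id i φ))))
             (↭ₚ.++⁺ φ↭S φ′↭S′))

  pot-preserved : ∀ j → i < j → j ≤ n → pot Δ G j ≡ pot Δ G″ (j + m)
  pot-preserved j i<j j≤n = subst (λ j → pot Δ G j ≡ pot Δ G″ (j + m)) i+q≡j
    (Vecₚ.tabulate-cong λ l → trans (sym (Vecₚ.lookup∘tabulate _ l)) (trans (lookups l) (Vecₚ.lookup∘tabulate _ l)))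
    where
    q ρ : ℕ
    q = j ∸ i
    ρ = n ∸ j
    i+q≡j : i + q ≡ j
    i+q≡j = m+[n∸m]≡n (<⇒≤ i<j)
    q+ρ≡r : q + ρ ≡ r
    q+ρ≡r = +-cancelˡ-≡ i _ _ (trans (sym (+-assoc i q ρ)) (trans (cong (_+ ρ) i+q≡j) (trans (m+[n∸m]≡n j≤n) (sym i+r≡n))))
    open Window q ρ q+ρ≡r
    i+q+m≡κ : (i + q) + m ≡ κ
    i+q+m≡κ = trans (+-assoc i q m) (cong (i +_) (+-comm q m))
    κ+ρ≡|φ″| : κ + ρ ≡ length φ″
    κ+ρ≡|φ″| = trans (+-assoc i (m + q) ρ) (trans (cong (i +_) (trans (+-assoc m q ρ) (cong (m +_) q+ρ≡r))) (sym |φ″|))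
    lookups : ∀ l → Vec.lookup (pot Δ G (i + q)) l ≡ Vec.lookup (pot Δ G″ ((i + q) + m)) l
    lookups l = begin
      Vec.lookup (pot Δ G (i + q)) l
        ≡⟨ pot-lookup Δ G g (arcℕ-represents G) (arcℕ-forward G) (i + q) ρ (trans (+-assoc i q ρ) (trans (cong (i +_) q+ρ≡r) i+r≡n)) l ⟩
      ∑[ k < i + q ] ⟦ suc (toℕ l) ≤ᵇ outdegInto g (i + q) ρ k ⟧      ≡⟨ ∑-window (λ v → ⟦ suc (toℕ l) ≤ᵇ v ⟧) refl ⟨
      ∑[ k < κ ] ⟦ suc (toℕ l) ≤ᵇ outdegInto spliced κ ρ k ⟧          ≡⟨ pot-lookup Δ G″ spliced (λ _ _ → refl) spliced-fwd κ ρ κ+ρ≡|φ″| l ⟨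
      Vec.lookup (pot Δ G″ κ) l                                      ≡⟨ cong (λ k → Vec.lookup (pot Δ G″ k) l) i+q+m≡κ ⟨
      Vec.lookup (pot Δ G″ ((i + q) + m)) l                          ∎
      where open ≡-Reasoning

lemma9 : (Δ : ℕ) → .{{_ : NonZero Δ}} →
    (S S' : DegSeq) → All (Bounded Δ) S → All (Bounded Δ) S' →
    (φ : List Elem) (G : TopDag (length φ)) → RTOWith φ S G →
    (φ' : List Elem) (p : Pot Δ) → PartialTO Δ φ' S' p p →
    (i : ℕ) → 1 ≤ i → i ≤ length φ → pot Δ G i ≡ p →
    Σ (TopDag (length (take i φ ++ φ' ++ drop i φ))) λ G'' →
      RTOWith (take i φ ++ φ' ++ drop i φ) (S ++ S') G'' ×
      (∀ (j : ℕ) → i < j → j ≤ length φ → pot Δ G j ≡ pot Δ G'' (j + length φ'))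
lemma9 Δ S S′ S-bounded S′-bounded φ G (φ↭S , G-realizes) φ′ p
       (Ps , Ps-valid , A , B , A↭Ps , B↭Pt , H , (ψ↭ , H-realizes) , potH) i _ i≤n potG =
  G″ , (φ″↭S++S′ , G″-realizes) , pot-preserved
  where open Insertion Δ S-bounded S′-bounded φ G φ↭S G-realizes φ′ p Ps Ps-valid A B A↭Ps B↭Pt
                       H ψ↭ H-realizes potH i i≤n potG
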